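{- Let $r$ be an integer with $r\geq 2$, and let $G$ be a finite simple graph of order $n$ with $n\geq 6r-12+\frac{8}{r}$. Put $L=\left\lfloor\frac{rn-2}{2r-1}\right\rfloor$. Assume that for every subset $X\subseteq V(G)$: if $|X|\geq L$ then $N_G(X)=V(G)$, and if $|X|<L$ then $$|N_G(X)|\geq\frac{(2r-1)(n-1)}{r(n-1)-2}|X|.$$ Then $G$ is fractional $r$-covered.
   Context: All graphs are finite, undirected and simple. For $X\subseteq V(G)$, $N_G(X)=\bigcup_{x\in X}N_G(x)$ is the set of vertices adjacent to at least one vertex of $X$. A fractional $r$-factor of a graph $G$ is a function $h:E(G)\to[0,1]$ such that $\sum_{e\in E(v)}h(e)=r$ for every vertex $v$, where $E(v)$ is the set of edges incident with $v$. A graph $G$ is fractional $r$-covered if for every edge $e$ of $G$ there is a fractional $r$-factor $h$ of $G$ with $h(e)=1$. -}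

module Defs where

open import Data.Nat using (ℕ; zero; suc; _+_; _*_; _∸_; _≤_; _<_)
open import Data.Nat.DivMod using (_/_)
open import Data.Fin using (Fin)
open import Data.Fin.Subset using (Subset; _∈_; ∣_∣)
open import Data.Bool using (Bool; true; false; if_then_else_)
open import Data.Vec using (tabulate)
open import Data.Product using (Σ; ∃; _×_; _,_)
open import Relation.Binary.PropositionalEquality using (_≡_)
open import Relation.Nullary using (¬_)
import Data.Rational as Q
open Q using (ℚ; 0ℚ; 1ℚ)
open import Data.Integer using (+_)

record Graph (n : ℕ) : Set where
  field
    adj   : Fin n → Fin n → Bool
    sym   : ∀ u v → adj u v ≡ adj v u
    irrefl : ∀ v → adj v v ≡ false
open Graph public

sumℚ : (n : ℕ) → (Fin n → ℚ) → ℚ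
sumℚ zero    f = 0ℚ
sumℚ (suc n) f = f Fin.zero Q.+ sumℚ n (λ i → f (Fin.suc i))

anyFin : (n : ℕ) → (Fin n → Bool) → Bool
anyFin zero    f = false
anyFin (suc n) f = f Fin.zero Data.Bool.∨ anyFin n (λ i → f (Fin.suc i))
  where import Data.Bool

N : ∀ {n} → Graph n → Subset n → Subset n
N {n} G X = tabulate λ v → anyFin n (λ x → Data.Vec.lookup X x Data.Bool.∧ adj G x v)
  where import Data.Vec; import Data.Bool

-- "N_G(X) = V(G)" : every vertex lies in N_G(X), i.e. is adjacent to some x ∈ X.
NeighAll : ∀ {n} → Graph n → Subset n → Set
NeighAll {n} G X = ∀ (v : Fin n) → ∃ λ (x : Fin n) → x ∈ X × adj G x v ≡ true

-- An edge-weighting: a function on E(G), represented as a function on ordered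
-- pairs that is symmetric on edges (values on non-edges are irrelevant).
-- h is a fractional r-factor: values in [0,1] on edges and
-- sum over edges incident with v equals r.
IsFracFactor : ∀ {n} → Graph n → ℕ → (Fin n → Fin n → ℚ) → Set
IsFracFactor {n} G r h =
    (∀ u v → adj G u v ≡ true → h u v ≡ h v u)
  × (∀ u v → adj G u v ≡ true → (0ℚ Q.≤ h u v) × (h u v Q.≤ 1ℚ))
  × (∀ v → sumℚ n (λ u → if adj G v u then h v u else 0ℚ) ≡ (+ r) Q./ 1)

FracCovered : ∀ {n} → Graph n → ℕ → Set
FracCovered {n} G r =
  ∀ u v → adj G u v ≡ true →
    Σ (Fin n → Fin n → ℚ) λ h → IsFracFactor G r h × h u v ≡ 1ℚ

-- L = ⌊(rn - 2)/(2r - 1)⌋ ; for r ≥ 1, suc (2r ∸ 2) = 2r - 1.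
Lval : ℕ → ℕ → ℕ
Lval r n = (r * n ∸ 2) / suc (2 * r ∸ 2)

module Submission where

-- A fractional r-factor with h(uv) = 1 is h(xy) = (F(x,y) + F(y,x))/2 for an r-regular spanning
-- subgraph F of the bipartite double cover of G containing the arcs (u,v) and (v,u). Such an F
-- exists by a Hall-type theorem for degree-constrained subgraphs of bipartite graphs: delete edges
-- while Hall's condition survives; in an edge-minimal graph every edge lies in a tight set, tight
-- sets are closed under intersection by submodularity, and this pins every degree down.
-- For the demands r − [x ∈ {u,v}], Hall's condition reduces to r(|A| + |Y|) + 2 ≤ e(A,Y) + rn,
-- where e(A,Y) counts arcs from A to Y. If |A| ≥ L, domination gives every vertex at least
-- |A| − L + 1 neighbours in A; if |A|, |Y| < L and |A| + |Y| ≥ n, the expansion of A forces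
-- enough of N(A) into Y.

open import Defs hiding (sym)
open import Data.Nat.Base
open import Data.Nat.Properties hiding (_≟_)
open import Data.Nat.DivMod using (_%_; m≡m%n+[m/n]*n; m%n<n)
open import Data.Nat.Tactic.RingSolver
open import Data.Bool.Base using (Bool; true; false; _∧_; _∨_; not; if_then_else_)
open import Data.Bool.Properties using (∧-zeroʳ; ∨-zeroʳ; ∧-comm; ∨-comm) renaming (_≟_ to _≟ᵇ_)
open import Data.Fin.Base using (Fin; zero; suc)
open import Data.Fin.Properties using (_≟_; any?)
open import Data.Fin.Subset using (Subset; ∣_∣; _∩_; _∪_; ⊤)
open import Data.Fin.Subset.Properties using (anySubset?; ∣p∣≤n; ∣p∣≡n⇒p≡⊤)
open import Data.Vec.Base using (lookup; tabulate; _∷_; [])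
open import Data.Vec.Properties using (lookup-zipWith; lookup∘tabulate; lookup-replicate; []=⇒lookup)
open import Data.Integer.Base using (ℤ)
import Data.Integer.Base as ℤ
open import Data.Integer.Properties using (pos-+)
import Data.Integer.Tactic.RingSolver as ℤ-Ring
open import Data.Rational.Base as ℚ using (ℚ; 0ℚ; 1ℚ)
import Data.Rational.Properties as ℚ
import Data.Rational.Unnormalised.Base as ℚᵘ
import Data.Rational.Unnormalised.Properties as ℚᵘ
open import Data.Product.Base using (Σ; ∃; _×_; _,_; proj₁; proj₂)
open import Data.Sum.Base using (inj₁; inj₂)
open import Data.Empty using (⊥; ⊥-elim)
open import Function.Base using (case_of_)
open import Relation.Binary.PropositionalEquality
open import Relation.Nullary using (¬_; Dec; yes; no; does; contradiction)
open import Relation.Nullary.Decidable using (_×-dec_; ¬?; dec-false; decidable-stable; toWitness)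
open import Algebra.Properties.CommutativeSemigroup +-commutativeSemigroup using (xy∙z≈xz∙y)
open import Algebra.Properties.CommutativeMonoid.Sum +-0-commutativeMonoid
  using (sum; sum-syntax; sum-cong-≗; sum-replicate-zero; ∑-distrib-+; ∑-comm)

_==_ : ∀ {n} → Fin n → Fin n → Bool
i == j = does (i ≟ j)

𝟙 : Bool → ℕ
𝟙 true  = 1
𝟙 false = 0

𝟙≤1 : ∀ b → 𝟙 b ≤ 1
𝟙≤1 true  = ≤-refl
𝟙≤1 false = z≤n

∑-mono-≤ : ∀ {n} {f g : Fin n → ℕ} → (∀ i → f i ≤ g i) → sum f ≤ sum g
∑-mono-≤ {zero}  f≤g = z≤n
∑-mono-≤ {suc n} f≤g = +-mono-≤ (f≤g zero) (∑-mono-≤ (λ i → f≤g (suc i)))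

∑-const : ∀ n c → ∑[ i < n ] c ≡ n * c
∑-const zero    c = refl
∑-const (suc n) c = cong (c +_) (∑-const n c)

∑-if : ∀ {n} (P : Fin n → Bool) c → ∑[ i < n ] (if P i then c else 0) ≡ ∑[ i < n ] 𝟙 (P i) * c
∑-if {zero}  P c = refl
∑-if {suc n} P c with P zero
... | true  = cong (c +_) (∑-if (λ i → P (suc i)) c)
... | false = ∑-if (λ i → P (suc i)) c

∑-δ : ∀ {n} (k : Fin n) (f : Fin n → ℕ) → ∑[ i < n ] (if i == k then f i else 0) ≡ f k
∑-δ {suc n} zero    f = trans (cong (f zero +_) (sum-replicate-zero n)) (+-identityʳ (f zero))
∑-δ {suc n} (suc k) f = ∑-δ k (λ i → f (suc i))

∑-squeeze : ∀ {n} {f g : Fin n → ℕ} → (∀ i → f i ≤ g i) → sum g ≤ sum f → ∀ i → f i ≡ g i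
∑-squeeze {suc n} {f} {g} f≤g ∑g≤∑f zero = ≤-antisym (f≤g zero)
  (+-cancelʳ-≤ (sum (λ i → f (suc i))) _ _
    (≤-trans (+-monoʳ-≤ (g zero) (∑-mono-≤ (λ i → f≤g (suc i)))) ∑g≤∑f))
∑-squeeze {suc n} {f} {g} f≤g ∑g≤∑f (suc i) = ∑-squeeze (λ j → f≤g (suc j))
  (+-cancelˡ-≤ (g zero) _ _ (≤-trans ∑g≤∑f (+-monoˡ-≤ _ (f≤g zero)))) i

∣_∣≡∑ : ∀ {n} (X : Subset n) → ∣ X ∣ ≡ ∑[ i < n ] 𝟙 (lookup X i)
∣ []         ∣≡∑ = refl
∣ true  ∷ X  ∣≡∑ = cong suc ∣ X ∣≡∑
∣ false ∷ X  ∣≡∑ = ∣ X ∣≡∑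

==-refl : ∀ {n} (i : Fin n) → i == i ≡ true
==-refl zero    = refl
==-refl (suc i) = ==-refl i

==⇒≡ : ∀ {n} {i j : Fin n} → i == j ≡ true → i ≡ j
==⇒≡ {i = i} {j} eq with i ≟ j
... | yes i≡j = i≡j

𝟙-∧-split : ∀ a e c → (c ≡ true → e ≡ true) →
  𝟙 (a ∧ e) ≡ 𝟙 (a ∧ (e ∧ not c)) + (if c then 𝟙 a else 0)
𝟙-∧-split true  true  true  _ = refl
𝟙-∧-split true  true  false _ = refl
𝟙-∧-split true  false true  h with () ← h refl
𝟙-∧-split true  false false _ = refl
𝟙-∧-split false e     true  _ = refl
𝟙-∧-split false e     false _ = refl

∧-elimˡ : ∀ {p q} → p ∧ q ≡ true → p ≡ true
∧-elimˡ {true} _ = refl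

if-∧ : ∀ p q (v : ℕ) → (if p ∧ q then v else 0) ≡ (if p then (if q then v else 0) else 0)
if-∧ true  q v = refl
if-∧ false q v = refl

∑-if-outside : ∀ {n} c (f : Fin n → ℕ) → ∑[ i < n ] (if c then f i else 0) ≡ (if c then sum f else 0)
∑-if-outside true  f = refl
∑-if-outside {n} false f = sum-replicate-zero n

-- Concavity of z ↦ c ⊓ z: here s ≥ p, q ≥ t and s + t = p + q.
⊓-concave : ∀ c s t p q → s + t ≡ p + q → t ≤ p → t ≤ q → c ⊓ s + c ⊓ t ≤ c ⊓ p + c ⊓ q
⊓-concave c s t p q s+t≡p+q t≤p t≤q with ≤-total s c
... | inj₁ s≤c = ≤-reflexive (begin-equality
      c ⊓ s + c ⊓ t ≡⟨ cong₂ _+_ (m≥n⇒m⊓n≡n s≤c) (m≥n⇒m⊓n≡n (≤-trans (≤-trans t≤p p≤s) s≤c)) ⟩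
      s + t         ≡⟨ s+t≡p+q ⟩
      p + q         ≡⟨ cong₂ _+_ (m≥n⇒m⊓n≡n (≤-trans p≤s s≤c)) (m≥n⇒m⊓n≡n (≤-trans q≤s s≤c)) ⟨
      c ⊓ p + c ⊓ q ∎)
  where
  open ≤-Reasoning
  p≤s : p ≤ s
  p≤s = +-cancelʳ-≤ q p s (≤-trans (≤-reflexive (sym s+t≡p+q)) (+-monoʳ-≤ s t≤q))
  q≤s : q ≤ s
  q≤s = +-cancelˡ-≤ p q s (≤-trans (≤-reflexive (sym s+t≡p+q)) (≤-trans (+-monoʳ-≤ s t≤p) (≤-reflexive (+-comm s p))))
... | inj₂ c≤s rewrite m≤n⇒m⊓n≡m c≤s with ≤-total c p | ≤-total c q
...   | inj₁ c≤p | _        rewrite m≤n⇒m⊓n≡m c≤p = +-monoʳ-≤ c (⊓-monoʳ-≤ c t≤q)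
...   | inj₂ p≤c | inj₁ c≤q rewrite m≥n⇒m⊓n≡n p≤c | m≤n⇒m⊓n≡m c≤q =
        ≤-trans (≤-reflexive (+-comm c (c ⊓ t))) (+-monoˡ-≤ c (≤-trans (m⊓n≤n c t) t≤p))
...   | inj₂ p≤c | inj₂ q≤c rewrite m≥n⇒m⊓n≡n p≤c | m≥n⇒m⊓n≡n q≤c =
        ≤-trans (+-mono-≤ c≤s (m⊓n≤n c t)) (≤-reflexive s+t≡p+q)

-- Degree-constrained subgraphs of bipartite graphs

BipartiteGraph : ℕ → Set
BipartiteGraph n = Fin n → Fin n → Bool

deg : ∀ {n} → BipartiteGraph n → Subset n → Fin n → ℕ
deg {n} E A y = ∑[ x < n ] 𝟙 (lookup A x ∧ E x y)

rowDeg colDeg : ∀ {n} → BipartiteGraph n → Fin n → ℕ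
rowDeg {n} E x = ∑[ y < n ] 𝟙 (E x y)
colDeg {n} E y = ∑[ x < n ] 𝟙 (E x y)

edgeCount : ∀ {n} → BipartiteGraph n → ℕ
edgeCount {n} E = ∑[ x < n ] rowDeg E x

_⊆ᴱ_ : ∀ {n} → BipartiteGraph n → BipartiteGraph n → Set
F ⊆ᴱ E = ∀ x y → F x y ≡ true → E x y ≡ true

module DegreeConstrainedSubgraph (n : ℕ) (α β : Fin n → ℕ) where

  demand : Subset n → ℕ
  demand A = ∑[ x < n ] (if lookup A x then α x else 0)

  supply : BipartiteGraph n → Subset n → ℕ
  supply E A = ∑[ y < n ] (β y ⊓ deg E A y)

  Hall : BipartiteGraph n → Set
  Hall E = ∀ A → demand A ≤ supply E A

  Tight : BipartiteGraph n → Subset n → Set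
  Tight E A = supply E A ≤ demand A

  Factor : BipartiteGraph n → Set
  Factor E = Σ (BipartiteGraph n) λ F → F ⊆ᴱ E × (∀ x → rowDeg F x ≡ α x) × (∀ y → colDeg F y ≤ β y)

  Violation : BipartiteGraph n → Set
  Violation E = ∃ λ A → supply E A < demand A

  violation? : ∀ E → Dec (Violation E)
  violation? E = anySubset? (λ A → supply E A <? demand A)

  ¬violation⇒hall : ∀ E → ¬ Violation E → Hall E
  ¬violation⇒hall E none A = ≮⇒≥ λ violated → none (A , violated)

  _∖_ : BipartiteGraph n → Fin n × Fin n → BipartiteGraph n
  (E ∖ (x , y)) a b = E a b ∧ not (a == x ∧ b == y)

  module EdgeRemoval (E : BipartiteGraph n) (x y : Fin n) (Exy : E x y ≡ true) where

    E′ : BipartiteGraph n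
    E′ = E ∖ (x , y)

    removed⇒edge : ∀ a b → a == x ∧ b == y ≡ true → E a b ≡ true
    removed⇒edge a b eq with a ≟ x | b ≟ y
    removed⇒edge a b eq | yes refl | yes refl = Exy

    edgeCount-∖ : suc (edgeCount E′) ≡ edgeCount E
    edgeCount-∖ = sym (begin
      edgeCount E
        ≡⟨ sum-cong-≗ (λ a → trans (sum-cong-≗ (λ b → 𝟙-∧-split true (E a b) _ (removed⇒edge a b)))
                                   (∑-distrib-+ (λ b → 𝟙 (E′ a b)) (λ b → if a == x ∧ b == y then 1 else 0))) ⟩
      ∑[ a < n ] (rowDeg E′ a + ∑[ b < n ] (if a == x ∧ b == y then 1 else 0))
        ≡⟨ ∑-distrib-+ (rowDeg E′) (λ a → ∑[ b < n ] (if a == x ∧ b == y then 1 else 0)) ⟩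
      edgeCount E′ + ∑[ a < n ] ∑[ b < n ] (if a == x ∧ b == y then 1 else 0)
        ≡⟨ cong (edgeCount E′ +_) (begin
             ∑[ a < n ] ∑[ b < n ] (if a == x ∧ b == y then 1 else 0)
               ≡⟨ sum-cong-≗ (λ a → trans (sum-cong-≗ (λ b → if-∧ (a == x) (b == y) 1))
                                          (∑-if-outside (a == x) (λ b → if b == y then 1 else 0))) ⟩
             ∑[ a < n ] (if a == x then ∑[ b < n ] (if b == y then 1 else 0) else 0)
               ≡⟨ ∑-δ x (λ _ → ∑[ b < n ] (if b == y then 1 else 0)) ⟩
             ∑[ b < n ] (if b == y then 1 else 0)
               ≡⟨ ∑-δ y (λ _ → 1) ⟩
             1 ∎) ⟩
      edgeCount E′ + 1
        ≡⟨ +-comm (edgeCount E′) 1 ⟩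
      suc (edgeCount E′) ∎)
      where open ≡-Reasoning

    deg-∖ : ∀ A b → deg E A b ≡ deg E′ A b + (if b == y then 𝟙 (lookup A x) else 0)
    deg-∖ A b = begin
      deg E A b
        ≡⟨ sum-cong-≗ (λ a → trans (𝟙-∧-split (lookup A a) (E a b) _ (removed⇒edge a b))
                                   (cong (𝟙 (lookup A a ∧ E′ a b) +_) (if-∧ (a == x) (b == y) _))) ⟩
      ∑[ a < n ] (𝟙 (lookup A a ∧ E′ a b) + (if a == x then (if b == y then 𝟙 (lookup A a) else 0) else 0))
        ≡⟨ ∑-distrib-+ (λ a → 𝟙 (lookup A a ∧ E′ a b)) (λ a → if a == x then (if b == y then 𝟙 (lookup A a) else 0) else 0) ⟩
      deg E′ A b + ∑[ a < n ] (if a == x then (if b == y then 𝟙 (lookup A a) else 0) else 0)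
        ≡⟨ cong (deg E′ A b +_) (∑-δ x (λ a → if b == y then 𝟙 (lookup A a) else 0)) ⟩
      deg E′ A b + (if b == y then 𝟙 (lookup A x) else 0) ∎
      where open ≡-Reasoning

    supply-∖ : ∀ A → supply E A ≤ supply E′ A + 𝟙 (lookup A x)
    supply-∖ A = begin
      supply E A
        ≡⟨ sum-cong-≗ (λ b → cong (β b ⊓_) (deg-∖ A b)) ⟩
      ∑[ b < n ] (β b ⊓ (deg E′ A b + (if b == y then 𝟙 (lookup A x) else 0)))
        ≤⟨ ∑-mono-≤ (λ b → ⊓-+-≤ (β b) (deg E′ A b) _) ⟩
      ∑[ b < n ] (β b ⊓ deg E′ A b + (if b == y then 𝟙 (lookup A x) else 0))
        ≡⟨ ∑-distrib-+ (λ b → β b ⊓ deg E′ A b) (λ b → if b == y then 𝟙 (lookup A x) else 0) ⟩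
      supply E′ A + ∑[ b < n ] (if b == y then 𝟙 (lookup A x) else 0)
        ≡⟨ cong (supply E′ A +_) (∑-δ y (λ _ → 𝟙 (lookup A x))) ⟩
      supply E′ A + 𝟙 (lookup A x) ∎
      where
      open ≤-Reasoning
      ⊓-+-≤ : ∀ c p q → c ⊓ (p + q) ≤ c ⊓ p + q
      ⊓-+-≤ c p q = ≤-trans (⊓-monoˡ-≤ (p + q) (m≤m+n c q)) (≤-reflexive (sym (+-distribʳ-⊓ q c p)))

    supply-∖-outside : ∀ A → lookup A x ≡ false → supply E A ≡ supply E′ A
    supply-∖-outside A x∉A = sum-cong-≗ λ b → cong (β b ⊓_) (begin
      deg E A b                                                 ≡⟨ deg-∖ A b ⟩
      deg E′ A b + (if b == y then 𝟙 (lookup A x) else 0)       ≡⟨ cong (λ z → deg E′ A b + (if b == y then 𝟙 z else 0)) x∉A ⟩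
      deg E′ A b + (if b == y then 0 else 0)                    ≡⟨ cong (deg E′ A b +_) (if-same (b == y)) ⟩
      deg E′ A b + 0                                            ≡⟨ +-identityʳ _ ⟩
      deg E′ A b ∎)
      where
      open ≡-Reasoning
      if-same : ∀ c → (if c then 0 else 0) ≡ 0
      if-same true  = refl
      if-same false = refl

    supply-∖-saturated : ∀ A → β y < deg E A y → supply E A ≡ supply E′ A
    supply-∖-saturated A β<deg = sum-cong-≗ λ b → capped b (b ≟ y)
      where
      capped : ∀ b → Dec (b ≡ y) → β b ⊓ deg E A b ≡ β b ⊓ deg E′ A b
      capped b (no b≢y) = cong (β b ⊓_) (begin
        deg E A b                                                  ≡⟨ deg-∖ A b ⟩
        deg E′ A b + (if b == y then 𝟙 (lookup A x) else 0)        ≡⟨ cong (λ c → deg E′ A b + (if c then _ else 0)) (dec-false (b ≟ y) b≢y) ⟩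
        deg E′ A b + 0                                             ≡⟨ +-identityʳ _ ⟩
        deg E′ A b ∎)
        where open ≡-Reasoning
      capped b (yes refl) = trans (m≤n⇒m⊓n≡m (<⇒≤ β<deg)) (sym (m≤n⇒m⊓n≡m β≤deg′))
        where
        β≤deg′ : β y ≤ deg E′ A y
        β≤deg′ = ≤-pred (begin-strict
          β y                                                  <⟨ β<deg ⟩
          deg E A y                                            ≡⟨ deg-∖ A y ⟩
          deg E′ A y + (if y == y then 𝟙 (lookup A x) else 0)  ≡⟨ cong (λ c → deg E′ A y + (if c then 𝟙 (lookup A x) else 0)) (==-refl y) ⟩
          deg E′ A y + 𝟙 (lookup A x)                          ≤⟨ +-monoʳ-≤ (deg E′ A y) (𝟙≤1 (lookup A x)) ⟩
          deg E′ A y + 1                                       ≡⟨ +-comm (deg E′ A y) 1 ⟩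
          suc (deg E′ A y)                                     ∎)
          where open ≤-Reasoning

    violation-∖ : Hall E → ∀ A → supply E′ A < demand A →
      lookup A x ≡ true × deg E A y ≤ β y × Tight E A
    violation-∖ hall A violated = x∈A , unsaturated , tight
      where
      x∈A : lookup A x ≡ true
      x∈A with lookup A x in eq
      ... | true  = refl
      ... | false = ⊥-elim (<⇒≱ violated (≤-trans (hall A) (≤-reflexive (supply-∖-outside A eq))))
      unsaturated : deg E A y ≤ β y
      unsaturated with deg E A y ≤? β y
      ... | yes ≤β = ≤β
      ... | no ≰β  = ⊥-elim (<⇒≱ violated (≤-trans (hall A) (≤-reflexive (supply-∖-saturated A (≰⇒> ≰β)))))
      tight : Tight E A
      tight = ≤-trans (supply-∖ A) (≤-trans (+-monoʳ-≤ (supply E′ A) (𝟙≤1 (lookup A x)))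
                (≤-trans (≤-reflexive (+-comm _ 1)) violated))

  demand-modular : ∀ A B → demand (A ∪ B) + demand (A ∩ B) ≡ demand A + demand B
  demand-modular A B = begin
    demand (A ∪ B) + demand (A ∩ B)
      ≡⟨ ∑-distrib-+ (λ z → if lookup (A ∪ B) z then α z else 0) (λ z → if lookup (A ∩ B) z then α z else 0) ⟨
    ∑[ z < n ] ((if lookup (A ∪ B) z then α z else 0) + (if lookup (A ∩ B) z then α z else 0))
      ≡⟨ sum-cong-≗ (λ z → trans (cong₂ (λ p q → (if p then α z else 0) + (if q then α z else 0))
                                        (lookup-zipWith _∨_ z A B) (lookup-zipWith _∧_ z A B))
                                 (pointwise (lookup A z) (lookup B z) (α z))) ⟩
    ∑[ z < n ] ((if lookup A z then α z else 0) + (if lookup B z then α z else 0))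
      ≡⟨ ∑-distrib-+ (λ z → if lookup A z then α z else 0) (λ z → if lookup B z then α z else 0) ⟩
    demand A + demand B ∎
    where
    open ≡-Reasoning
    pointwise : ∀ a b (v : ℕ) → (if a ∨ b then v else 0) + (if a ∧ b then v else 0) ≡ (if a then v else 0) + (if b then v else 0)
    pointwise true  true  v = refl
    pointwise true  false v = refl
    pointwise false true  v = +-comm v 0
    pointwise false false v = refl

  deg-modular : ∀ E A B y → deg E (A ∪ B) y + deg E (A ∩ B) y ≡ deg E A y + deg E B y
  deg-modular E A B y = begin
    deg E (A ∪ B) y + deg E (A ∩ B) y
      ≡⟨ ∑-distrib-+ (λ z → 𝟙 (lookup (A ∪ B) z ∧ E z y)) (λ z → 𝟙 (lookup (A ∩ B) z ∧ E z y)) ⟨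
    ∑[ z < n ] (𝟙 (lookup (A ∪ B) z ∧ E z y) + 𝟙 (lookup (A ∩ B) z ∧ E z y))
      ≡⟨ sum-cong-≗ (λ z → trans (cong₂ (λ p q → 𝟙 (p ∧ E z y) + 𝟙 (q ∧ E z y))
                                        (lookup-zipWith _∨_ z A B) (lookup-zipWith _∧_ z A B))
                                 (pointwise (lookup A z) (lookup B z) (E z y))) ⟩
    ∑[ z < n ] (𝟙 (lookup A z ∧ E z y) + 𝟙 (lookup B z ∧ E z y))
      ≡⟨ ∑-distrib-+ (λ z → 𝟙 (lookup A z ∧ E z y)) (λ z → 𝟙 (lookup B z ∧ E z y)) ⟩
    deg E A y + deg E B y ∎
    where
    open ≡-Reasoning
    pointwise : ∀ a b e → 𝟙 ((a ∨ b) ∧ e) + 𝟙 ((a ∧ b) ∧ e) ≡ 𝟙 (a ∧ e) + 𝟙 (b ∧ e)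
    pointwise true  true  e = refl
    pointwise true  false e = refl
    pointwise false true  e = +-identityʳ (𝟙 e)
    pointwise false false e = refl

  _⊑_ : Subset n → Subset n → Set
  A ⊑ B = ∀ z → lookup A z ≡ true → lookup B z ≡ true

  deg-mono : ∀ E {A B} y → A ⊑ B → deg E A y ≤ deg E B y
  deg-mono E {A} {B} y A⊑B = ∑-mono-≤ λ z → pointwise (lookup A z) (lookup B z) (E z y) (A⊑B z)
    where
    pointwise : ∀ a b e → (a ≡ true → b ≡ true) → 𝟙 (a ∧ e) ≤ 𝟙 (b ∧ e)
    pointwise true  b e a⇒b rewrite a⇒b refl = ≤-refl
    pointwise false b e a⇒b = z≤n

  ∩-⊑ˡ : ∀ A B → (A ∩ B) ⊑ A
  ∩-⊑ˡ A B z z∈ with lookup A z | trans (sym (lookup-zipWith _∧_ z A B)) z∈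
  ... | true | _ = refl

  ∩-⊑ʳ : ∀ A B → (A ∩ B) ⊑ B
  ∩-⊑ʳ A B z z∈ with lookup A z | lookup B z | trans (sym (lookup-zipWith _∧_ z A B)) z∈
  ... | true | true | _ = refl

  ∈-∩ : ∀ (A B : Subset n) z → lookup A z ≡ true → lookup B z ≡ true → lookup (A ∩ B) z ≡ true
  ∈-∩ A B z z∈A z∈B = trans (lookup-zipWith _∧_ z A B) (cong₂ _∧_ z∈A z∈B)

  supply-submodular : ∀ E A B → supply E (A ∪ B) + supply E (A ∩ B) ≤ supply E A + supply E B
  supply-submodular E A B = begin
    supply E (A ∪ B) + supply E (A ∩ B)
      ≡⟨ ∑-distrib-+ (λ y → β y ⊓ deg E (A ∪ B) y) (λ y → β y ⊓ deg E (A ∩ B) y) ⟨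
    ∑[ y < n ] (β y ⊓ deg E (A ∪ B) y + β y ⊓ deg E (A ∩ B) y)
      ≤⟨ ∑-mono-≤ (λ y → ⊓-concave (β y) _ _ _ _ (deg-modular E A B y)
                           (deg-mono E {A ∩ B} {A} y (∩-⊑ˡ A B)) (deg-mono E {A ∩ B} {B} y (∩-⊑ʳ A B))) ⟩
    ∑[ y < n ] (β y ⊓ deg E A y + β y ⊓ deg E B y)
      ≡⟨ ∑-distrib-+ (λ y → β y ⊓ deg E A y) (λ y → β y ⊓ deg E B y) ⟩
    supply E A + supply E B ∎
    where open ≤-Reasoning

  tight-∩ : ∀ E → Hall E → ∀ A B → Tight E A → Tight E B → Tight E (A ∩ B)
  tight-∩ E hall A B tA tB = +-cancelˡ-≤ (demand (A ∪ B)) _ _ (begin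
    demand (A ∪ B) + supply E (A ∩ B)   ≤⟨ +-monoˡ-≤ _ (hall (A ∪ B)) ⟩
    supply E (A ∪ B) + supply E (A ∩ B) ≤⟨ supply-submodular E A B ⟩
    supply E A + supply E B             ≤⟨ +-mono-≤ tA tB ⟩
    demand A + demand B                 ≡⟨ demand-modular A B ⟨
    demand (A ∪ B) + demand (A ∩ B)     ∎)
    where open ≤-Reasoning

  split-off : ∀ (g : Bool → ℕ) → g false ≡ 0 → ∀ i c → g i ≡ g (i ∧ not c) + (if c then g i else 0)
  split-off g g0 true  true  = sym (cong (_+ g true) g0)
  split-off g g0 true  false = sym (+-identityʳ (g true))
  split-off g g0 false true  = sym (trans (cong (g false +_) g0) (+-identityʳ (g false)))
  split-off g g0 false false = sym (+-identityʳ (g false))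

  module RowDegree (E : BipartiteGraph n) (hall : Hall E) (x : Fin n) where

    α≤rowDeg : α x ≤ rowDeg E x
    α≤rowDeg = begin
      α x         ≡⟨ demand-⁅x⁆ ⟨
      demand ⁅x⁆  ≤⟨ hall ⁅x⁆ ⟩
      supply E ⁅x⁆ ≤⟨ ∑-mono-≤ (λ y → ≤-trans (m⊓n≤n (β y) _) (≤-reflexive (deg-⁅x⁆ y))) ⟩
      rowDeg E x  ∎
      where
      open ≤-Reasoning
      ⁅x⁆ : Subset n
      ⁅x⁆ = tabulate (_== x)
      demand-⁅x⁆ : demand ⁅x⁆ ≡ α x
      demand-⁅x⁆ = trans (sum-cong-≗ (λ z → cong (λ b → if b then α z else 0) (lookup∘tabulate (_== x) z))) (∑-δ x α)
      deg-⁅x⁆ : ∀ y → deg E ⁅x⁆ y ≡ 𝟙 (E x y)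
      deg-⁅x⁆ y = trans (sum-cong-≗ (λ z → trans (cong (λ b → 𝟙 (b ∧ E z y)) (lookup∘tabulate (_== x) z)) (𝟙-∧ (z == x) (E z y))))
                        (∑-δ x (λ z → 𝟙 (E z y)))
        where
        𝟙-∧ : ∀ c e → 𝟙 (c ∧ e) ≡ (if c then 𝟙 e else 0)
        𝟙-∧ true  e = refl
        𝟙-∧ false e = refl

    rowDeg≤α : ∀ I → Tight E I → lookup I x ≡ true → (∀ y → E x y ≡ true → deg E I y ≤ β y) → rowDeg E x ≤ α x
    rowDeg≤α I tight x∈I unsaturated = +-cancelʳ-≤ (supply E I′) _ _ (begin
      rowDeg E x + supply E I′ ≡⟨ +-comm (rowDeg E x) _ ⟩
      supply E I′ + rowDeg E x ≡⟨ supply-split ⟨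
      supply E I               ≤⟨ tight ⟩
      demand I                 ≡⟨ demand-split ⟩
      demand I′ + α x          ≤⟨ +-monoˡ-≤ (α x) (hall I′) ⟩
      supply E I′ + α x        ≡⟨ +-comm _ (α x) ⟩
      α x + supply E I′        ∎)
      where
      open ≤-Reasoning
      I′ : Subset n
      I′ = tabulate (λ z → lookup I z ∧ not (z == x))
      remove-x : ∀ (g : Fin n → Bool → ℕ) → (∀ z → g z false ≡ 0) →
        ∑[ z < n ] g z (lookup I z) ≡ ∑[ z < n ] g z (lookup I′ z) + g x true
      remove-x g g0 = begin-equality
        ∑[ z < n ] g z (lookup I z)
          ≡⟨ sum-cong-≗ (λ z → trans (split-off (g z) (g0 z) (lookup I z) (z == x))
                               (cong (λ b → g z b + (if z == x then g z (lookup I z) else 0)) (sym (lookup∘tabulate (λ z → lookup I z ∧ not (z == x)) z)))) ⟩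
        ∑[ z < n ] (g z (lookup I′ z) + (if z == x then g z (lookup I z) else 0))
          ≡⟨ ∑-distrib-+ (λ z → g z (lookup I′ z)) (λ z → if z == x then g z (lookup I z) else 0) ⟩
        ∑[ z < n ] g z (lookup I′ z) + ∑[ z < n ] (if z == x then g z (lookup I z) else 0)
          ≡⟨ cong (∑[ z < n ] g z (lookup I′ z) +_) (trans (∑-δ x (λ z → g z (lookup I z))) (cong (g x) x∈I)) ⟩
        ∑[ z < n ] g z (lookup I′ z) + g x true ∎
      demand-split : demand I ≡ demand I′ + α x
      demand-split = remove-x (λ z b → if b then α z else 0) (λ _ → refl)
      deg-split : ∀ y → deg E I y ≡ deg E I′ y + 𝟙 (E x y)
      deg-split y = remove-x (λ z b → 𝟙 (b ∧ E z y)) (λ _ → refl)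
      capped-split : ∀ y → β y ⊓ deg E I y ≡ β y ⊓ deg E I′ y + 𝟙 (E x y)
      capped-split y with E x y in Exy
      ... | false = trans (cong (β y ⊓_) (trans (deg-split y) (cong (λ b → deg E I′ y + 𝟙 b) Exy)))
                          (trans (cong (β y ⊓_) (+-identityʳ _)) (sym (+-identityʳ _)))
      ... | true  = begin-equality
        β y ⊓ deg E I y      ≡⟨ m≥n⇒m⊓n≡n (unsaturated y Exy) ⟩
        deg E I y            ≡⟨ deg-split y ⟩
        deg E I′ y + 𝟙 (E x y) ≡⟨ cong (λ b → deg E I′ y + 𝟙 b) Exy ⟩
        deg E I′ y + 1       ≡⟨ cong (_+ 1) (m≥n⇒m⊓n≡n (≤-trans (m≤m+n _ 1) deg′+1≤β)) ⟨
        β y ⊓ deg E I′ y + 1 ∎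
        where
        deg′+1≤β : deg E I′ y + 1 ≤ β y
        deg′+1≤β = ≤-trans (≤-reflexive (trans (cong (λ b → deg E I′ y + 𝟙 b) (sym Exy)) (sym (deg-split y)))) (unsaturated y Exy)
      supply-split : supply E I ≡ supply E I′ + rowDeg E x
      supply-split = trans (sum-cong-≗ capped-split) (∑-distrib-+ (λ y → β y ⊓ deg E I′ y) (λ y → 𝟙 (E x y)))

  ⋂-with : ∀ {k} → (Fin k → Subset n) → Subset n → Subset n
  ⋂-with {zero}  T B = B
  ⋂-with {suc k} T B = T zero ∩ ⋂-with (λ i → T (suc i)) B

  tight-⋂ : ∀ E → Hall E → ∀ {k} (T : Fin k → Subset n) B → Tight E B → (∀ i → Tight E (T i)) → Tight E (⋂-with T B)
  tight-⋂ E hall {zero}  T B tB tT = tB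
  tight-⋂ E hall {suc k} T B tB tT =
    tight-∩ E hall (T zero) _ (tT zero) (tight-⋂ E hall (λ i → T (suc i)) B tB (λ i → tT (suc i)))

  ∈-⋂ : ∀ {k} (T : Fin k → Subset n) B z → lookup B z ≡ true → (∀ i → lookup (T i) z ≡ true) → lookup (⋂-with T B) z ≡ true
  ∈-⋂ {zero}  T B z z∈B z∈T = z∈B
  ∈-⋂ {suc k} T B z z∈B z∈T = ∈-∩ (T zero) _ z (z∈T zero) (∈-⋂ (λ i → T (suc i)) B z z∈B (λ i → z∈T (suc i)))

  ⋂-⊑ : ∀ {k} (T : Fin k → Subset n) B i → ⋂-with T B ⊑ T i
  ⋂-⊑ T B zero    = ∩-⊑ˡ (T zero) _
  ⋂-⊑ T B (suc i) z z∈ = ⋂-⊑ (λ j → T (suc j)) B i z (∩-⊑ʳ (T zero) _ z z∈)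

  -- When no edge can be deleted without violating Hall's condition, E itself is the required subgraph.
  module Minimal (E : BipartiteGraph n) (hall : Hall E)
    (critical : ∀ x y → E x y ≡ true → Violation (E ∖ (x , y))) where

    TightThrough : Fin n → Fin n → Set
    TightThrough x y = Σ (Subset n) λ A → Tight E A × lookup A x ≡ true × (E x y ≡ true → deg E A y ≤ β y)

    tightThrough : ∀ x y → E x y ≡ true → TightThrough x y
    tightThrough x y Exy with critical x y Exy
    ... | A , violated with EdgeRemoval.violation-∖ E x y Exy hall A violated
    ...   | x∈A , unsaturated , tight = A , tight , x∈A , λ _ → unsaturated

    -- I intersects, over the neighbours y of x, tight sets through x in which y is unsaturated.
    rowDeg≤α : ∀ x → rowDeg E x ≤ α x
    rowDeg≤α x with any? (λ y → E x y ≟ᵇ true)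
    ... | no isolated = ≤-trans (≤-reflexive (trans (sum-cong-≗ no-edge) (sum-replicate-zero n))) z≤n
      where
      no-edge : ∀ y → 𝟙 (E x y) ≡ 0
      no-edge y with E x y in Exy
      ... | true  = ⊥-elim (isolated (y , Exy))
      ... | false = refl
    ... | yes (y₀ , Exy₀) = RowDegree.rowDeg≤α E hall x I (tight-⋂ E hall T B tB (λ y → proj₁ (proj₂ (choice y))))
                             (∈-⋂ T B x x∈B (λ y → proj₁ (proj₂ (proj₂ (choice y)))))
                             (λ y Exy → ≤-trans (deg-mono E {I} {T y} y (⋂-⊑ T B y)) (proj₂ (proj₂ (proj₂ (choice y))) Exy))
      where
      base : TightThrough x y₀
      base = tightThrough x y₀ Exy₀
      B : Subset n
      B = proj₁ base
      tB : Tight E B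
      tB = proj₁ (proj₂ base)
      x∈B : lookup B x ≡ true
      x∈B = proj₁ (proj₂ (proj₂ base))
      choice : ∀ y → TightThrough x y
      choice y with E x y ≟ᵇ true
      ... | yes Exy = tightThrough x y Exy
      ... | no ¬Exy = B , tB , x∈B , λ Exy → ⊥-elim (¬Exy Exy)
      T : Fin n → Subset n
      T y = proj₁ (choice y)
      I : Subset n
      I = ⋂-with T B

    rows : ∀ x → rowDeg E x ≡ α x
    rows x = ≤-antisym (rowDeg≤α x) (RowDegree.α≤rowDeg E hall x)

    cols : ∀ y → colDeg E y ≤ β y
    cols y = ≤-trans (≤-reflexive (sym (capped y))) (m⊓n≤m (β y) _)
      where
      total : sum (colDeg E) ≤ ∑[ b < n ] (β b ⊓ colDeg E b)
      total = begin
        sum (colDeg E)                 ≡⟨ ∑-comm (λ a b → 𝟙 (E a b)) ⟨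
        sum (rowDeg E)                 ≡⟨ sum-cong-≗ rows ⟩
        sum α                          ≡⟨ sum-cong-≗ (λ z → cong (λ b → if b then α z else 0) (lookup-replicate z true)) ⟨
        demand ⊤                       ≤⟨ hall ⊤ ⟩
        supply E ⊤                     ≡⟨ sum-cong-≗ (λ b → cong (β b ⊓_) (sum-cong-≗ (λ z → cong (λ c → 𝟙 (c ∧ E z b)) (lookup-replicate z true)))) ⟩
        ∑[ b < n ] (β b ⊓ colDeg E b) ∎
        where open ≤-Reasoning
      capped : ∀ b → β b ⊓ colDeg E b ≡ colDeg E b
      capped   = ∑-squeeze (λ b → m⊓n≤n (β b) (colDeg E b)) total

  factor-below : ∀ k E → edgeCount E < k → Hall E → Factor E
  factor-below (suc k) E bound hall
    with any? (λ x → any? (λ y → (E x y ≟ᵇ true) ×-dec ¬? (violation? (E ∖ (x , y)))))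
  ... | yes (x , y , Exy , removable) with factor-below k (E ∖ (x , y))
         (≤-trans (≤-reflexive (EdgeRemoval.edgeCount-∖ E x y Exy)) (≤-pred bound))
         (¬violation⇒hall (E ∖ (x , y)) removable)
  ...   | F , F⊆E∖xy , rows , cols = F , (λ a b Fab → ∧-elimˡ (F⊆E∖xy a b Fab)) , rows , cols
  factor-below (suc k) E bound hall | no minimal =
    E , (λ _ _ Exy → Exy) , Minimal.rows E hall critical , Minimal.cols E hall critical
    where
    critical : ∀ x y → E x y ≡ true → Violation (E ∖ (x , y))
    critical x y Exy = decidable-stable (violation? (E ∖ (x , y))) λ removable → minimal (x , y , Exy , removable)

  factor : ∀ E → Hall E → Factor E
  factor E = factor-below (suc (edgeCount E)) E ≤-refl

-- Arithmetic of L = ⌊(rn − 2)/(2r − 1)⌋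

module LvalDivision (ρ n : ℕ) (size : 6 * (2 + ρ) * (2 + ρ) + 8 ≤ (2 + ρ) * n + 12 * (2 + ρ)) where

  size′ : 8 + 12 * ρ + 6 * ρ * ρ ≤ (2 + ρ) * n
  size′ = +-cancelʳ-≤ (12 * (2 + ρ)) _ _ (≤-trans (≤-reflexive (expand ρ)) size)
    where
    expand : ∀ ρ → 8 + 12 * ρ + 6 * ρ * ρ + 12 * (2 + ρ) ≡ 6 * (2 + ρ) * (2 + ρ) + 8
    expand = solve-∀

  2r∸1≡c : 2 * (2 + ρ) ∸ 1 ≡ 3 + 2 * ρ
  2r∸1≡c = cong (_∸ 1) (2r≡1+c ρ)
    where
    2r≡1+c : ∀ ρ → 2 * (2 + ρ) ≡ 1 + (3 + 2 * ρ)
    2r≡1+c = solve-∀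

  divisor≡c : suc (2 * (2 + ρ) ∸ 2) ≡ 3 + 2 * ρ
  divisor≡c = cong (λ z → suc (z ∸ 2)) (2r≡2+[c∸1] ρ)
    where
    2r≡2+[c∸1] : ∀ ρ → 2 * (2 + ρ) ≡ 2 + (2 + 2 * ρ)
    2r≡2+[c∸1] = solve-∀

  remainder : ℕ
  remainder = ((2 + ρ) * n ∸ 2) % suc (2 * (2 + ρ) ∸ 2)

  division : (2 + ρ) * n ≡ remainder + Lval (2 + ρ) n * (3 + 2 * ρ) + 2
  division = begin
    (2 + ρ) * n                                           ≡⟨ m∸n+n≡m (≤-trans (m≤m+n 2 _) size′) ⟨
    (2 + ρ) * n ∸ 2 + 2                                   ≡⟨ cong (_+ 2) (m≡m%n+[m/n]*n ((2 + ρ) * n ∸ 2) (suc (2 * (2 + ρ) ∸ 2))) ⟩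
    remainder + Lval (2 + ρ) n * suc (2 * (2 + ρ) ∸ 2) + 2 ≡⟨ cong (λ z → remainder + Lval (2 + ρ) n * z + 2) divisor≡c ⟩
    remainder + Lval (2 + ρ) n * (3 + 2 * ρ) + 2           ∎
    where open ≡-Reasoning

  remainder<c : remainder < 3 + 2 * ρ
  remainder<c = subst (remainder <_) divisor≡c (m%n<n ((2 + ρ) * n ∸ 2) (suc (2 * (2 + ρ) ∸ 2)))

≤-by-slack : ∀ {x y} z → x + z ≡ y → x ≤ y
≤-by-slack {x} z x+z≡y = ≤-trans (m≤m+n x z) (≤-reflexive x+z≡y)

-- Here r = 2 + ρ, c = 2r − 1, and L, D are the quotient and remainder of rn − 2 by c.
module FloorArithmetic (ρ n L D : ℕ)
  (size : 8 + 12 * ρ + 6 * ρ * ρ ≤ (2 + ρ) * n)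
  (division : (2 + ρ) * n ≡ D + L * (3 + 2 * ρ) + 2)
  (D<c : D < 3 + 2 * ρ) where

  2ρ+2≤L : 2 * ρ + 2 ≤ L
  2ρ+2≤L = ≮⇒≥ λ L<2ρ+2 → <-irrefl refl (begin-strict
    (2 + ρ) * n                                  ≡⟨ division ⟩
    D + L * (3 + 2 * ρ) + 2                      <⟨ +-monoˡ-< 2 (+-mono-<-≤ D<c (*-monoˡ-≤ (3 + 2 * ρ) (L≤1+2ρ L<2ρ+2))) ⟩
    (3 + 2 * ρ) + (1 + 2 * ρ) * (3 + 2 * ρ) + 2  ≤⟨ ≤-by-slack (2 * ρ + 2 * ρ * ρ) (expand ρ) ⟩
    8 + 12 * ρ + 6 * ρ * ρ                       ≤⟨ size ⟩
    (2 + ρ) * n                                  ∎)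
    where
    open ≤-Reasoning
    expand : ∀ ρ → (3 + 2 * ρ) + (1 + 2 * ρ) * (3 + 2 * ρ) + 2 + (2 * ρ + 2 * ρ * ρ) ≡ 8 + 12 * ρ + 6 * ρ * ρ
    expand = solve-∀
    L≤1+2ρ : L < 2 * ρ + 2 → L ≤ 1 + 2 * ρ
    L≤1+2ρ L< = ≤-pred (subst (suc L ≤_) (+-comm (2 * ρ) 2) L<)

  L+r≤n+1 : L + (2 + ρ) ≤ n + 1
  L+r≤n+1 = *-cancelˡ-≤ ((2 + ρ) * (3 + 2 * ρ)) (+-cancelʳ-≤ ((2 + ρ) * (D + 2)) _ _ (begin
    (2 + ρ) * (3 + 2 * ρ) * (L + (2 + ρ)) + (2 + ρ) * (D + 2)
      ≡⟨ regroup ρ D L ⟩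
    (2 + ρ) * (D + L * (3 + 2 * ρ) + 2) + (2 + ρ) * (3 + 2 * ρ) * (2 + ρ)
      ≡⟨ cong (λ z → (2 + ρ) * z + (2 + ρ) * (3 + 2 * ρ) * (2 + ρ)) division ⟨
    (2 + ρ) * ((2 + ρ) * n) + (2 + ρ) * (3 + 2 * ρ) * (2 + ρ)
      ≤⟨ ≤-by-slack (6 + 9 * ρ + 9 * ρ * ρ + 4 * ρ * ρ * ρ) (cubic ρ n) ⟩
    (2 + ρ) * ((2 + ρ) * n) + ((1 + ρ) * (8 + 12 * ρ + 6 * ρ * ρ) + (2 + ρ) * (5 + 2 * ρ))
      ≤⟨ +-monoʳ-≤ ((2 + ρ) * ((2 + ρ) * n)) (+-monoˡ-≤ ((2 + ρ) * (5 + 2 * ρ)) (*-monoʳ-≤ (1 + ρ) size)) ⟩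
    (2 + ρ) * ((2 + ρ) * n) + ((1 + ρ) * ((2 + ρ) * n) + (2 + ρ) * (5 + 2 * ρ))
      ≤⟨ ≤-by-slack ((2 + ρ) * D) (collect ρ n D) ⟩
    (2 + ρ) * (3 + 2 * ρ) * (n + 1) + (2 + ρ) * (D + 2) ∎))
    where
    open ≤-Reasoning
    regroup : ∀ ρ D L → (2 + ρ) * (3 + 2 * ρ) * (L + (2 + ρ)) + (2 + ρ) * (D + 2)
                      ≡ (2 + ρ) * (D + L * (3 + 2 * ρ) + 2) + (2 + ρ) * (3 + 2 * ρ) * (2 + ρ)
    regroup = solve-∀
    cubic : ∀ ρ n → (2 + ρ) * ((2 + ρ) * n) + (2 + ρ) * (3 + 2 * ρ) * (2 + ρ) + (6 + 9 * ρ + 9 * ρ * ρ + 4 * ρ * ρ * ρ)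
                  ≡ (2 + ρ) * ((2 + ρ) * n) + ((1 + ρ) * (8 + 12 * ρ + 6 * ρ * ρ) + (2 + ρ) * (5 + 2 * ρ))
    cubic = solve-∀
    collect : ∀ ρ n D → (2 + ρ) * ((2 + ρ) * n) + ((1 + ρ) * ((2 + ρ) * n) + (2 + ρ) * (5 + 2 * ρ)) + (2 + ρ) * D
                      ≡ (2 + ρ) * (3 + 2 * ρ) * (n + 1) + (2 + ρ) * (D + 2)
    collect = solve-∀

  2r[L+t]+2≤[L+t][t+1]+rn : ∀ t → 2 * (2 + ρ) * (L + t) + 2 ≤ (L + t) * suc t + (2 + ρ) * n
  2r[L+t]+2≤[L+t][t+1]+rn t =
    subst (λ x → 2 * (2 + ρ) * (L + t) + 2 ≤ (L + t) * suc t + x) (sym division) (bound t)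
    where
    bound : ∀ t → 2 * (2 + ρ) * (L + t) + 2 ≤ (L + t) * suc t + (D + L * (3 + 2 * ρ) + 2)
    bound zero    = ≤-by-slack D (at-zero ρ L D)
      where
      at-zero : ∀ ρ L D → 2 * (2 + ρ) * (L + 0) + 2 + D ≡ (L + 0) * 1 + (D + L * (3 + 2 * ρ) + 2)
      at-zero = solve-∀
    bound (suc t) = extend (m≤n⇒∃[o]m+o≡n 2ρ+2≤L)
      where
      at-suc : ∀ ρ M t D → 2 * (2 + ρ) * (2 * ρ + 2 + M + suc t) + 2 + ((1 + t) * (M + t) + D)
                         ≡ (2 * ρ + 2 + M + suc t) * suc (suc t) + (D + (2 * ρ + 2 + M) * (3 + 2 * ρ) + 2)
      at-suc = solve-∀
      extend : ∃ (λ M → 2 * ρ + 2 + M ≡ L) →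
        2 * (2 + ρ) * (L + suc t) + 2 ≤ (L + suc t) * suc (suc t) + (D + L * (3 + 2 * ρ) + 2)
      extend (M , eq) = subst (λ L → 2 * (2 + ρ) * (L + suc t) + 2 ≤ (L + suc t) * suc (suc t) + (D + L * (3 + 2 * ρ) + 2))
                              eq (≤-by-slack ((1 + t) * (M + t) + D) (at-suc ρ M t D))

  large-set : ∀ a b t → a ≡ L + t → b ≤ a → a < n → (2 + ρ) * (a + b) + 2 ≤ b * suc t + (2 + ρ) * n
  large-set a b t a≡L+t b≤a a<n with ≤-total (2 + ρ) (suc t)
  ... | inj₁ r≤1+t = begin
    (2 + ρ) * (a + b) + 2           ≤⟨ ≤-by-slack ρ (regroup ρ a b) ⟩
    b * (2 + ρ) + (2 + ρ) * suc a   ≤⟨ +-mono-≤ (*-monoʳ-≤ b r≤1+t) (*-monoʳ-≤ (2 + ρ) a<n) ⟩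
    b * suc t + (2 + ρ) * n         ∎
    where
    open ≤-Reasoning
    regroup : ∀ ρ a b → (2 + ρ) * (a + b) + 2 + ρ ≡ b * (2 + ρ) + (2 + ρ) * suc a
    regroup = solve-∀
  ... | inj₂ 1+t≤r with w , refl ← m≤n⇒∃[o]m+o≡n b≤a = +-cancelʳ-≤ (w * suc t) _ _ (begin
    (2 + ρ) * (b + w + b) + 2 + w * suc t    ≤⟨ +-monoʳ-≤ ((2 + ρ) * (b + w + b) + 2) (*-monoʳ-≤ w 1+t≤r) ⟩
    (2 + ρ) * (b + w + b) + 2 + w * (2 + ρ)  ≡⟨ regroup₁ ρ b w ⟩
    2 * (2 + ρ) * (b + w) + 2                ≤⟨ subst (λ x → 2 * (2 + ρ) * x + 2 ≤ x * suc t + (2 + ρ) * n) (sym a≡L+t)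
                                                      (2r[L+t]+2≤[L+t][t+1]+rn t) ⟩
    (b + w) * suc t + (2 + ρ) * n            ≡⟨ regroup₂ b w (suc t) ((2 + ρ) * n) ⟩
    b * suc t + (2 + ρ) * n + w * suc t      ∎)
    where
    open ≤-Reasoning
    regroup₁ : ∀ ρ b w → (2 + ρ) * (b + w + b) + 2 + w * (2 + ρ) ≡ 2 * (2 + ρ) * (b + w) + 2
    regroup₁ = solve-∀
    regroup₂ : ∀ b w s x → (b + w) * s + x ≡ b * s + x + w * s
    regroup₂ = solve-∀

  -- (1+ρ)(2+ρ)·[m + n + 1 ≤ a + L] + (1+ρ)²·[a + 1 ≤ L] + (1+ρ)·[Lc + 2 ≤ rn], rearranged.
  small-sets-linear : ∀ a b m → suc a ≤ L → suc b ≤ L → a + b ≡ n + m → (2 + ρ) * ((1 + ρ) * m + 2) ≤ (1 + ρ) * a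
  small-sets-linear a b m a<L b<L a+b≡n+m = ≤-trans (m≤m+n _ (1 + 5 * ρ + 2 * ρ * ρ)) (+-cancelʳ-≤ common _ _ (begin
    (2 + ρ) * ((1 + ρ) * m + 2) + (1 + 5 * ρ + 2 * ρ * ρ) + common
      ≡⟨ expand-left ρ m n L a ⟩
    (1 + ρ) * (2 + ρ) * (m + n + 1) + (1 + ρ) * (1 + ρ) * suc a + (1 + ρ) * (L * (3 + 2 * ρ) + 2)
      ≤⟨ +-mono-≤ (+-mono-≤ (*-monoʳ-≤ ((1 + ρ) * (2 + ρ)) m+n+1≤a+L) (*-monoʳ-≤ ((1 + ρ) * (1 + ρ)) a<L))
                  (*-monoʳ-≤ (1 + ρ) Lc+2≤rn) ⟩
    (1 + ρ) * (2 + ρ) * (a + L) + (1 + ρ) * (1 + ρ) * L + (1 + ρ) * ((2 + ρ) * n)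
      ≡⟨ expand-right ρ a n L ⟩
    (1 + ρ) * a + common ∎))
    where
    open ≤-Reasoning
    common : ℕ
    common = (1 + ρ) * (1 + ρ) * a + (1 + ρ) * (2 + ρ) * n + (1 + ρ) * (2 + ρ) * L + (1 + ρ) * (1 + ρ) * L
    m+n+1≤a+L : m + n + 1 ≤ a + L
    m+n+1≤a+L = begin
      m + n + 1   ≡⟨ cong (_+ 1) (trans (+-comm m n) (sym a+b≡n+m)) ⟩
      a + b + 1   ≡⟨ trans (+-assoc a b 1) (cong (a +_) (+-comm b 1)) ⟩
      a + suc b   ≤⟨ +-monoʳ-≤ a b<L ⟩
      a + L       ∎
    Lc+2≤rn : L * (3 + 2 * ρ) + 2 ≤ (2 + ρ) * n
    Lc+2≤rn = ≤-trans (m≤n+m _ D) (≤-reflexive (trans (sym (+-assoc D _ 2)) (sym division)))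
    expand-left : ∀ ρ m n L a →
      (2 + ρ) * ((1 + ρ) * m + 2) + (1 + 5 * ρ + 2 * ρ * ρ)
        + ((1 + ρ) * (1 + ρ) * a + (1 + ρ) * (2 + ρ) * n + (1 + ρ) * (2 + ρ) * L + (1 + ρ) * (1 + ρ) * L)
      ≡ (1 + ρ) * (2 + ρ) * (m + n + 1) + (1 + ρ) * (1 + ρ) * suc a + (1 + ρ) * (L * (3 + 2 * ρ) + 2)
    expand-left = solve-∀
    expand-right : ∀ ρ a n L →
      (1 + ρ) * (2 + ρ) * (a + L) + (1 + ρ) * (1 + ρ) * L + (1 + ρ) * ((2 + ρ) * n)
      ≡ (1 + ρ) * a + ((1 + ρ) * (1 + ρ) * a + (1 + ρ) * (2 + ρ) * n + (1 + ρ) * (2 + ρ) * L + (1 + ρ) * (1 + ρ) * L)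
    expand-right = solve-∀

  3≤r[n∸1] : 3 ≤ (2 + ρ) * (n ∸ 1)
  3≤r[n∸1] = begin
    3                               ≤⟨ m+n≤o⇒m≤o∸n 3 {2 + ρ} (≤-trans (≤-by-slack (3 + 11 * ρ + 6 * ρ * ρ) (count ρ)) size) ⟩
    (2 + ρ) * n ∸ (2 + ρ)           ≡⟨ cong ((2 + ρ) * n ∸_) (*-identityʳ (2 + ρ)) ⟨
    (2 + ρ) * n ∸ (2 + ρ) * 1       ≡⟨ *-distribˡ-∸ (2 + ρ) n 1 ⟨
    (2 + ρ) * (n ∸ 1)               ∎
    where
    open ≤-Reasoning
    count : ∀ ρ → 3 + (2 + ρ) + (3 + 11 * ρ + 6 * ρ * ρ) ≡ 8 + 12 * ρ + 6 * ρ * ρ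
    count = solve-∀

  small-sets : ∀ a b m nbrs → suc a ≤ L → suc b ≤ L → a + b ≡ n + m →
    (3 + 2 * ρ) * (n ∸ 1) * a ≤ nbrs * ((2 + ρ) * (n ∸ 1) ∸ 2) → a + (1 + ρ) * m + 2 ≤ nbrs
  small-sets a b m nbrs a<L b<L a+b≡n+m expansion = *-cancelʳ-≤ _ nbrs K {{>-nonZero 0<K}} (begin
    (a + (1 + ρ) * m + 2) * K                      ≡⟨ split ρ a m K ⟩
    a * K + ((1 + ρ) * m + 2) * K                  ≤⟨ +-monoʳ-≤ (a * K) (*-monoʳ-≤ ((1 + ρ) * m + 2) K≤rn′) ⟩
    a * K + ((1 + ρ) * m + 2) * ((2 + ρ) * n′)     ≡⟨ cong (a * K +_) (regroup ρ m n′) ⟩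
    a * K + (2 + ρ) * ((1 + ρ) * m + 2) * n′       ≤⟨ +-monoʳ-≤ (a * K) (*-monoˡ-≤ n′ (small-sets-linear a b m a<L b<L a+b≡n+m)) ⟩
    a * K + (1 + ρ) * a * n′                       ≤⟨ +-monoˡ-≤ ((1 + ρ) * a * n′) (*-monoʳ-≤ a K≤rn′) ⟩
    a * ((2 + ρ) * n′) + (1 + ρ) * a * n′          ≡⟨ collect ρ a n′ ⟩
    (3 + 2 * ρ) * n′ * a                           ≤⟨ expansion ⟩
    nbrs * K                                       ∎)
    where
    open ≤-Reasoning
    n′ K : ℕ
    n′ = n ∸ 1
    K = (2 + ρ) * n′ ∸ 2
    K≤rn′ : K ≤ (2 + ρ) * n′
    K≤rn′ = m∸n≤m _ 2
    0<K : 0 < K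
    0<K = m+n≤o⇒m≤o∸n 1 3≤r[n∸1]
    split : ∀ ρ a m K → (a + (1 + ρ) * m + 2) * K ≡ a * K + ((1 + ρ) * m + 2) * K
    split = solve-∀
    regroup : ∀ ρ m n′ → ((1 + ρ) * m + 2) * ((2 + ρ) * n′) ≡ (2 + ρ) * ((1 + ρ) * m + 2) * n′
    regroup = solve-∀
    collect : ∀ ρ a n′ → a * ((2 + ρ) * n′) + (1 + ρ) * a * n′ ≡ (3 + 2 * ρ) * n′ * a
    collect = solve-∀

-- Counting edges between vertex sets

𝟙-anyFin : ∀ n (f : Fin n → Bool) → 𝟙 (anyFin n f) ≤ ∑[ i < n ] 𝟙 (f i)
𝟙-anyFin zero    f = z≤n
𝟙-anyFin (suc n) f = ≤-trans (𝟙-∨ (f zero) _) (+-monoʳ-≤ (𝟙 (f zero)) (𝟙-anyFin n (λ i → f (suc i))))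
  where
  𝟙-∨ : ∀ a b → 𝟙 (a ∨ b) ≤ 𝟙 a + 𝟙 b
  𝟙-∨ true  b = s≤s z≤n
  𝟙-∨ false b = ≤-refl

module EdgeCounting {n} (G : Graph n) where

  between : Subset n → Subset n → ℕ
  between A Y = ∑[ y < n ] (if lookup Y y then deg (adj G) A y else 0)

  between-sym : ∀ A Y → between A Y ≡ between Y A
  between-sym A Y = begin
    between A Y                                                 ≡⟨ sum-cong-≗ (λ y → inside (lookup Y y) _) ⟩
    ∑[ y < n ] ∑[ x < n ] 𝟙 (lookup Y y ∧ (lookup A x ∧ adj G x y)) ≡⟨ ∑-comm (λ y x → 𝟙 (lookup Y y ∧ (lookup A x ∧ adj G x y))) ⟩
    ∑[ x < n ] ∑[ y < n ] 𝟙 (lookup Y y ∧ (lookup A x ∧ adj G x y)) ≡⟨ sum-cong-≗ (λ x → sum-cong-≗ (λ y → swap (lookup Y y) (lookup A x) (Graph.sym G x y))) ⟩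
    ∑[ x < n ] ∑[ y < n ] 𝟙 (lookup A x ∧ (lookup Y y ∧ adj G y x)) ≡⟨ sum-cong-≗ (λ x → inside (lookup A x) _) ⟨
    between Y A                                                 ∎
    where
    open ≡-Reasoning
    inside : ∀ c (f : Fin n → Bool) → (if c then ∑[ i < n ] 𝟙 (f i) else 0) ≡ ∑[ i < n ] 𝟙 (c ∧ f i)
    inside true  f = refl
    inside false f = sym (sum-replicate-zero n)
    swap : ∀ a b {e e′} → e ≡ e′ → 𝟙 (a ∧ (b ∧ e)) ≡ 𝟙 (b ∧ (a ∧ e′))
    swap true  true  refl = refl
    swap true  false _    = refl
    swap false true  _    = refl
    swap false false _    = refl

  between-≥-mindeg : ∀ A Y k → (∀ y → k ≤ deg (adj G) A y) → ∣ Y ∣ * k ≤ between A Y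
  between-≥-mindeg A Y k mindeg = begin
    ∣ Y ∣ * k                                   ≡⟨ cong (_* k) ∣ Y ∣≡∑ ⟩
    ∑[ y < n ] 𝟙 (lookup Y y) * k               ≡⟨ ∑-if (lookup Y) k ⟨
    ∑[ y < n ] (if lookup Y y then k else 0)    ≤⟨ ∑-mono-≤ (λ y → if-mono (lookup Y y) (mindeg y)) ⟩
    between A Y                                 ∎
    where
    open ≤-Reasoning
    if-mono : ∀ c {x y} → x ≤ y → (if c then x else 0) ≤ (if c then y else 0)
    if-mono true  x≤y = x≤y
    if-mono false _   = z≤n

  between-≥-neighbourhood : ∀ A Y → ∣ Y ∣ + ∣ N G A ∣ ≤ between A Y + n
  between-≥-neighbourhood A Y = begin
    ∣ Y ∣ + ∣ N G A ∣                                              ≡⟨ cong₂ _+_ ∣ Y ∣≡∑ ∣ N G A ∣≡∑ ⟩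
    ∑[ y < n ] 𝟙 (lookup Y y) + ∑[ y < n ] 𝟙 (lookup (N G A) y)    ≡⟨ ∑-distrib-+ (λ y → 𝟙 (lookup Y y)) (λ y → 𝟙 (lookup (N G A) y)) ⟨
    ∑[ y < n ] (𝟙 (lookup Y y) + 𝟙 (lookup (N G A) y))             ≤⟨ ∑-mono-≤ pointwise ⟩
    ∑[ y < n ] ((if lookup Y y then deg (adj G) A y else 0) + 1)   ≡⟨ ∑-distrib-+ (λ y → if lookup Y y then deg (adj G) A y else 0) (λ _ → 1) ⟩
    between A Y + ∑[ y < n ] 1                                     ≡⟨ cong (between A Y +_) (trans (∑-const n 1) (*-identityʳ n)) ⟩
    between A Y + n                                                ∎
    where
    open ≤-Reasoning
    inN≤deg : ∀ y → 𝟙 (lookup (N G A) y) ≤ deg (adj G) A y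
    inN≤deg y = ≤-trans (≤-reflexive (cong 𝟙 (lookup∘tabulate _ y))) (𝟙-anyFin n _)
    pointwise : ∀ y → 𝟙 (lookup Y y) + 𝟙 (lookup (N G A) y) ≤ (if lookup Y y then deg (adj G) A y else 0) + 1
    pointwise y with lookup Y y
    ... | true  = ≤-trans (≤-reflexive (+-comm 1 _)) (+-monoˡ-≤ 1 (inN≤deg y))
    ... | false = 𝟙≤1 _

  non-neighbours : Subset n → Fin n → Subset n
  non-neighbours A y = tabulate (λ x → lookup A x ∧ not (adj G x y))

  non-neighbour-nonadjacent : ∀ A y x → lookup (non-neighbours A y) x ≡ true → adj G x y ≡ false
  non-neighbour-nonadjacent A y x x∈ with lookup A x | adj G x y | trans (sym (lookup∘tabulate (λ x → lookup A x ∧ not (adj G x y)) x)) x∈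
  ... | true | false | _ = refl

  ∣A∣≡∣non-neighbours∣+deg : ∀ A y → ∣ A ∣ ≡ ∣ non-neighbours A y ∣ + deg (adj G) A y
  ∣A∣≡∣non-neighbours∣+deg A y = begin
    ∣ A ∣                                  ≡⟨ ∣ A ∣≡∑ ⟩
    ∑[ x < n ] 𝟙 (lookup A x)              ≡⟨ sum-cong-≗ (λ x → trans (pointwise (lookup A x) (adj G x y))
                                                 (cong (λ b → 𝟙 b + 𝟙 (lookup A x ∧ adj G x y)) (sym (lookup∘tabulate _ x)))) ⟩
    ∑[ x < n ] (𝟙 (lookup (non-neighbours A y) x) + 𝟙 (lookup A x ∧ adj G x y))
                                           ≡⟨ ∑-distrib-+ (λ x → 𝟙 (lookup (non-neighbours A y) x)) (λ x → 𝟙 (lookup A x ∧ adj G x y)) ⟩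
    ∑[ x < n ] 𝟙 (lookup (non-neighbours A y) x) + deg (adj G) A y ≡⟨ cong (_+ deg (adj G) A y) ∣ non-neighbours A y ∣≡∑ ⟨
    ∣ non-neighbours A y ∣ + deg (adj G) A y      ∎
    where
    open ≡-Reasoning
    pointwise : ∀ a e → 𝟙 a ≡ 𝟙 (a ∧ not e) + 𝟙 (a ∧ e)
    pointwise true  true  = refl
    pointwise true  false = refl
    pointwise false e     = refl

  -- The vertices of A outside N(y) cannot dominate y, so there are fewer than L of them.
  deg-≥-via-domination : ∀ L → (∀ X → L ≤ ∣ X ∣ → NeighAll G X) → ∀ A y → suc ∣ A ∣ ≤ deg (adj G) A y + L
  deg-≥-via-domination L dominating A y with L ≤? ∣ non-neighbours A y ∣
  ... | yes L≤∣Z∣ with x , x∈Z , xy ← dominating (non-neighbours A y) L≤∣Z∣ y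
    = contradiction (trans (sym xy) (non-neighbour-nonadjacent A y x ([]=⇒lookup x∈Z))) λ ()
  ... | no  ∣Z∣≮L = begin
    suc ∣ A ∣                                      ≡⟨ cong suc (∣A∣≡∣non-neighbours∣+deg A y) ⟩
    suc (∣ non-neighbours A y ∣ + deg (adj G) A y) ≡⟨ cong suc (+-comm ∣ non-neighbours A y ∣ _) ⟩
    suc (deg (adj G) A y + ∣ non-neighbours A y ∣) ≡⟨ +-suc _ ∣ non-neighbours A y ∣ ⟨
    deg (adj G) A y + suc ∣ non-neighbours A y ∣   ≤⟨ +-monoʳ-≤ _ (≰⇒> ∣Z∣≮L) ⟩
    deg (adj G) A y + L                            ∎
    where open ≤-Reasoning

module HallInequality (ρ n : ℕ) (G : Graph n)
  (size : 6 * (2 + ρ) * (2 + ρ) + 8 ≤ (2 + ρ) * n + 12 * (2 + ρ))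
  (dominating : ∀ (X : Subset n) → Lval (2 + ρ) n ≤ ∣ X ∣ → NeighAll G X)
  (expanding : ∀ (X : Subset n) → ∣ X ∣ < Lval (2 + ρ) n →
    (2 * (2 + ρ) ∸ 1) * (n ∸ 1) * ∣ X ∣ ≤ ∣ N G X ∣ * ((2 + ρ) * (n ∸ 1) ∸ 2)) where

  open EdgeCounting G
  open LvalDivision ρ n size
  open FloorArithmetic ρ n (Lval (2 + ρ) n) remainder size′ division remainder<c

  private
    L : ℕ
    L = Lval (2 + ρ) n

  many-neighbours : ∀ A t → L + t ≡ ∣ A ∣ → ∀ y → suc t ≤ deg (adj G) A y
  many-neighbours A t L+t≡∣A∣ y = +-cancelʳ-≤ L _ _ (begin
    suc t + L           ≡⟨ cong suc (trans (+-comm t L) L+t≡∣A∣) ⟩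
    suc ∣ A ∣           ≤⟨ deg-≥-via-domination L dominating A y ⟩
    deg (adj G) A y + L ∎)
    where open ≤-Reasoning

  via-large : ∀ A Y → L ≤ ∣ A ∣ → ∣ Y ∣ ≤ ∣ A ∣ → ∣ A ∣ < n →
    (2 + ρ) * (∣ A ∣ + ∣ Y ∣) + 2 ≤ between A Y + (2 + ρ) * n
  via-large A Y L≤∣A∣ ∣Y∣≤∣A∣ ∣A∣<n with t , L+t≡∣A∣ ← m≤n⇒∃[o]m+o≡n L≤∣A∣ =
    ≤-trans (large-set ∣ A ∣ ∣ Y ∣ t (sym L+t≡∣A∣) ∣Y∣≤∣A∣ ∣A∣<n)
            (+-monoˡ-≤ ((2 + ρ) * n) (between-≥-mindeg A Y (suc t) (many-neighbours A t L+t≡∣A∣)))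

  via-small : ∀ A Y → ∣ A ∣ < L → ∣ Y ∣ < L → n ≤ ∣ A ∣ + ∣ Y ∣ →
    (2 + ρ) * (∣ A ∣ + ∣ Y ∣) + 2 ≤ between A Y + (2 + ρ) * n
  via-small A Y ∣A∣<L ∣Y∣<L n≤∣A∣+∣Y∣ with m , n+m≡∣A∣+∣Y∣ ← m≤n⇒∃[o]m+o≡n n≤∣A∣+∣Y∣ =
    +-cancelʳ-≤ n _ _ (begin
      (2 + ρ) * (∣ A ∣ + ∣ Y ∣) + 2 + n                      ≡⟨ cong (λ z → (2 + ρ) * z + 2 + n) n+m≡∣A∣+∣Y∣ ⟨
      (2 + ρ) * (n + m) + 2 + n                              ≡⟨ regroup ρ n m ⟩
      (n + m) + (1 + ρ) * m + 2 + (2 + ρ) * n                ≡⟨ cong (λ z → z + (1 + ρ) * m + 2 + (2 + ρ) * n) n+m≡∣A∣+∣Y∣ ⟩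
      ∣ A ∣ + ∣ Y ∣ + (1 + ρ) * m + 2 + (2 + ρ) * n          ≡⟨ regroup′ ∣ A ∣ ∣ Y ∣ ((1 + ρ) * m) ((2 + ρ) * n) ⟩
      ∣ Y ∣ + (∣ A ∣ + (1 + ρ) * m + 2) + (2 + ρ) * n        ≤⟨ +-monoˡ-≤ ((2 + ρ) * n) (+-monoʳ-≤ ∣ Y ∣ enough-neighbours) ⟩
      ∣ Y ∣ + ∣ N G A ∣ + (2 + ρ) * n                        ≤⟨ +-monoˡ-≤ ((2 + ρ) * n) (between-≥-neighbourhood A Y) ⟩
      between A Y + n + (2 + ρ) * n                          ≡⟨ xy∙z≈xz∙y (between A Y) n _ ⟩
      between A Y + (2 + ρ) * n + n                          ∎)
    where
    open ≤-Reasoning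
    enough-neighbours : ∣ A ∣ + (1 + ρ) * m + 2 ≤ ∣ N G A ∣
    enough-neighbours = small-sets (∣ A ∣) (∣ Y ∣) m (∣ N G A ∣) ∣A∣<L ∣Y∣<L (sym n+m≡∣A∣+∣Y∣)
      (subst (λ c → c * (n ∸ 1) * ∣ A ∣ ≤ ∣ N G A ∣ * ((2 + ρ) * (n ∸ 1) ∸ 2)) 2r∸1≡c (expanding A ∣A∣<L))
    regroup : ∀ ρ n m → (2 + ρ) * (n + m) + 2 + n ≡ (n + m) + (1 + ρ) * m + 2 + (2 + ρ) * n
    regroup = solve-∀
    regroup′ : ∀ a b x y → a + b + x + 2 + y ≡ b + (a + x + 2) + y
    regroup′ = solve-∀

  edges-bound-ordered : ∀ A Y → ∣ Y ∣ ≤ ∣ A ∣ → ∣ A ∣ < n → (2 + ρ) * (∣ A ∣ + ∣ Y ∣) + 2 ≤ between A Y + (2 + ρ) * n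
  edges-bound-ordered A Y ∣Y∣≤∣A∣ ∣A∣<n with suc (∣ A ∣ + ∣ Y ∣) ≤? n | L ≤? ∣ A ∣
  ... | yes ∣A∣+∣Y∣<n | _ = begin
    (2 + ρ) * (∣ A ∣ + ∣ Y ∣) + 2       ≤⟨ +-monoʳ-≤ _ (m≤m+n 2 ρ) ⟩
    (2 + ρ) * (∣ A ∣ + ∣ Y ∣) + (2 + ρ) ≡⟨ trans (*-suc (2 + ρ) _) (+-comm (2 + ρ) _) ⟨
    (2 + ρ) * suc (∣ A ∣ + ∣ Y ∣)       ≤⟨ *-monoʳ-≤ (2 + ρ) ∣A∣+∣Y∣<n ⟩
    (2 + ρ) * n                         ≤⟨ m≤n+m _ (between A Y) ⟩
    between A Y + (2 + ρ) * n           ∎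
    where open ≤-Reasoning
  ... | no _          | yes L≤∣A∣ = via-large A Y L≤∣A∣ ∣Y∣≤∣A∣ ∣A∣<n
  ... | no ∣A∣+∣Y∣≮n  | no ∣A∣≱L  =
    via-small A Y (≰⇒> ∣A∣≱L) (≤-<-trans ∣Y∣≤∣A∣ (≰⇒> ∣A∣≱L)) (≤-pred (≰⇒> ∣A∣+∣Y∣≮n))

  edges-bound : ∀ A Y → ∣ A ∣ < n → ∣ Y ∣ < n → (2 + ρ) * (∣ A ∣ + ∣ Y ∣) + 2 ≤ between A Y + (2 + ρ) * n
  edges-bound A Y ∣A∣<n ∣Y∣<n with ≤-total ∣ Y ∣ ∣ A ∣
  ... | inj₁ ∣Y∣≤∣A∣ = edges-bound-ordered A Y ∣Y∣≤∣A∣ ∣A∣<n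
  ... | inj₂ ∣A∣≤∣Y∣ = subst₂ (λ s e → (2 + ρ) * s + 2 ≤ e + (2 + ρ) * n) (+-comm ∣ Y ∣ ∣ A ∣) (between-sym Y A)
                          (edges-bound-ordered Y A ∣A∣≤∣Y∣ ∣Y∣<n)

  L≤n : L ≤ n
  L≤n = ≤-trans (m≤m+n L (1 + ρ)) (≤-pred (subst₂ _≤_ (+-suc L (1 + ρ)) (+-comm n 1) L+r≤n+1))

  edges-bound-full : ∀ A Y → ∣ A ∣ ≡ n → (2 + ρ) * (∣ A ∣ + ∣ Y ∣) ≤ between A Y + (2 + ρ) * n
  edges-bound-full A Y ∣A∣≡n = via (m≤n⇒∃[o]m+o≡n L≤n)
    where
    via : ∃ (λ t → L + t ≡ n) → (2 + ρ) * (∣ A ∣ + ∣ Y ∣) ≤ between A Y + (2 + ρ) * n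
    via (t , L+t≡n) = begin
      (2 + ρ) * (∣ A ∣ + ∣ Y ∣)        ≡⟨ cong (λ a → (2 + ρ) * (a + ∣ Y ∣)) ∣A∣≡n ⟩
      (2 + ρ) * (n + ∣ Y ∣)            ≡⟨ trans (*-distribˡ-+ (2 + ρ) n ∣ Y ∣) (+-comm ((2 + ρ) * n) ((2 + ρ) * ∣ Y ∣)) ⟩
      (2 + ρ) * ∣ Y ∣ + (2 + ρ) * n    ≡⟨ cong (_+ (2 + ρ) * n) (*-comm (2 + ρ) ∣ Y ∣) ⟩
      ∣ Y ∣ * (2 + ρ) + (2 + ρ) * n    ≤⟨ +-monoˡ-≤ _ (*-monoʳ-≤ ∣ Y ∣ r≤1+t) ⟩
      ∣ Y ∣ * suc t + (2 + ρ) * n      ≤⟨ +-monoˡ-≤ _ (between-≥-mindeg A Y (suc t) (many-neighbours A t (trans L+t≡n (sym ∣A∣≡n)))) ⟩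
      between A Y + (2 + ρ) * n        ∎
      where
      open ≤-Reasoning
      r≤1+t : 2 + ρ ≤ suc t
      r≤1+t = +-cancelˡ-≤ L _ _ (begin
        L + (2 + ρ) ≤⟨ L+r≤n+1 ⟩
        n + 1       ≡⟨ cong (_+ 1) L+t≡n ⟨
        L + t + 1   ≡⟨ trans (+-assoc L t 1) (cong (L +_) (+-comm t 1)) ⟩
        L + suc t   ∎)

∣X∣≡n⇒∈ : ∀ {n} (X : Subset n) → ∣ X ∣ ≡ n → ∀ x → lookup X x ≡ true
∣X∣≡n⇒∈ X ∣X∣≡n x = trans (cong (λ p → lookup p x) (∣p∣≡n⇒p≡⊤ {p = X} ∣X∣≡n)) (lookup-replicate x true)

if-∨-disjoint : ∀ p q (w : ℕ) → (p ∧ q ≡ true → ⊥) → (if p ∨ q then w else 0) ≡ (if p then w else 0) + (if q then w else 0)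
if-∨-disjoint true  true  w disjoint = ⊥-elim (disjoint refl)
if-∨-disjoint true  false w _ = sym (+-identityʳ w)
if-∨-disjoint false q     w _ = refl

if-if : ∀ b c (w : ℕ) → (if b then (if c then w else 0) else 0) ≡ (if c then (if b then w else 0) else 0)
if-if true  true  w = refl
if-if true  false w = refl
if-if false true  w = refl
if-if false false w = refl

-- Forcing the edge uv: remove the arcs (u,v), (v,u) and lower the demands of u and v by one.
module ForcedEdge (ρ n : ℕ) (G : Graph n)
  (size : 6 * (2 + ρ) * (2 + ρ) + 8 ≤ (2 + ρ) * n + 12 * (2 + ρ))
  (dominating : ∀ (X : Subset n) → Lval (2 + ρ) n ≤ ∣ X ∣ → NeighAll G X)
  (expanding : ∀ (X : Subset n) → ∣ X ∣ < Lval (2 + ρ) n →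
    (2 * (2 + ρ) ∸ 1) * (n ∸ 1) * ∣ X ∣ ≤ ∣ N G X ∣ * ((2 + ρ) * (n ∸ 1) ∸ 2))
  (u v : Fin n) (u≢v : u ≢ v) where

  open EdgeCounting G
  open HallInequality ρ n G size dominating expanding

  endpoint : Fin n → Bool
  endpoint x = x == u ∨ x == v

  α : Fin n → ℕ
  α x = (2 + ρ) ∸ 𝟙 (endpoint x)

  forced : Fin n → Fin n → Bool
  forced x y = (x == u ∧ y == v) ∨ (x == v ∧ y == u)

  E₀ : BipartiteGraph n
  E₀ x y = adj G x y ∧ not (forced x y)

  open DegreeConstrainedSubgraph n α α

  not-both : ∀ x → x == u ∧ x == v ≡ true → ⊥
  not-both x both with x ≟ u | x ≟ v
  not-both x both | yes refl | yes refl = u≢v refl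

  ∑-endpoint : ∀ (f : Fin n → ℕ) → ∑[ x < n ] (if endpoint x then f x else 0) ≡ f u + f v
  ∑-endpoint f = begin
    ∑[ x < n ] (if endpoint x then f x else 0)
      ≡⟨ sum-cong-≗ (λ x → if-∨-disjoint (x == u) (x == v) (f x) (not-both x)) ⟩
    ∑[ x < n ] ((if x == u then f x else 0) + (if x == v then f x else 0))
      ≡⟨ ∑-distrib-+ (λ x → if x == u then f x else 0) (λ x → if x == v then f x else 0) ⟩
    ∑[ x < n ] (if x == u then f x else 0) + ∑[ x < n ] (if x == v then f x else 0)
      ≡⟨ cong₂ _+_ (∑-δ u f) (∑-δ v f) ⟩
    f u + f v ∎
    where open ≡-Reasoning

  ∑-forced : ∀ (g : Fin n → ℕ) y → ∑[ x < n ] (if forced x y then g x else 0) ≡ (if y == v then g u else 0) + (if y == u then g v else 0)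
  ∑-forced g y = begin
    ∑[ x < n ] (if forced x y then g x else 0)
      ≡⟨ sum-cong-≗ (λ x → trans (if-∨-disjoint (x == u ∧ y == v) (x == v ∧ y == u) (g x) (disjoint x))
                                 (cong₂ _+_ (if-∧ (x == u) (y == v) (g x)) (if-∧ (x == v) (y == u) (g x)))) ⟩
    ∑[ x < n ] ((if x == u then (if y == v then g x else 0) else 0) + (if x == v then (if y == u then g x else 0) else 0))
      ≡⟨ ∑-distrib-+ (λ x → if x == u then (if y == v then g x else 0) else 0) (λ x → if x == v then (if y == u then g x else 0) else 0) ⟩
    ∑[ x < n ] (if x == u then (if y == v then g x else 0) else 0) + ∑[ x < n ] (if x == v then (if y == u then g x else 0) else 0)
      ≡⟨ cong₂ _+_ (∑-δ u (λ x → if y == v then g x else 0)) (∑-δ v (λ x → if y == u then g x else 0)) ⟩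
    (if y == v then g u else 0) + (if y == u then g v else 0) ∎
    where
    open ≡-Reasoning
    disjoint : ∀ x → (x == u ∧ y == v) ∧ (x == v ∧ y == u) ≡ true → ⊥
    disjoint x both = not-both x (∧-pick (x == u) (y == v) (x == v) (y == u) both)
      where
      ∧-pick : ∀ a b c d → (a ∧ b) ∧ (c ∧ d) ≡ true → a ∧ c ≡ true
      ∧-pick true  b     true  d _ = refl
      ∧-pick true  true  false d ()
      ∧-pick true  false c     d ()
      ∧-pick false b     c     d ()

  module _ (uv : adj G u v ≡ true) where

    forced⇒adj : ∀ x y → forced x y ≡ true → adj G x y ≡ true
    forced⇒adj x y f with x == u in xu | y == v in yv | x == v in xv | y == u in yu
    ... | true | true | _ | _ = subst₂ (λ a b → adj G a b ≡ true) (sym (==⇒≡ xu)) (sym (==⇒≡ yv)) uv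
    ... | _ | _ | true | true = subst₂ (λ a b → adj G a b ≡ true) (sym (==⇒≡ xv)) (sym (==⇒≡ yu)) (trans (Graph.sym G v u) uv)
    forced⇒adj x y () | true  | false | true  | false
    forced⇒adj x y () | true  | false | false | _
    forced⇒adj x y () | false | _     | true  | false
    forced⇒adj x y () | false | _     | false | _

    Δ : Subset n → Subset n → ℕ
    Δ A Y = 𝟙 (lookup A u ∨ lookup Y v) + 𝟙 (lookup A v ∨ lookup Y u)

    edges-bound-Δ : ∀ A Y → (2 + ρ) * (∣ A ∣ + ∣ Y ∣) + 2 ≤ between A Y + Δ A Y + (2 + ρ) * n
    edges-bound-Δ A Y with ∣ A ∣ <? n | ∣ Y ∣ <? n
    ... | yes ∣A∣<n | yes ∣Y∣<n = ≤-trans (edges-bound A Y ∣A∣<n ∣Y∣<n) (+-monoˡ-≤ ((2 + ρ) * n) (m≤m+n (between A Y) (Δ A Y)))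
    ... | no ∣A∣≮n | _ = begin
      (2 + ρ) * (∣ A ∣ + ∣ Y ∣) + 2    ≤⟨ +-monoˡ-≤ 2 (edges-bound-full A Y ∣A∣≡n) ⟩
      between A Y + (2 + ρ) * n + 2    ≡⟨ xy∙z≈xz∙y (between A Y) _ 2 ⟩
      between A Y + 2 + (2 + ρ) * n    ≡⟨ cong (λ d → between A Y + d + (2 + ρ) * n) Δ≡2 ⟨
      between A Y + Δ A Y + (2 + ρ) * n ∎
      where
      open ≤-Reasoning
      ∣A∣≡n : ∣ A ∣ ≡ n
      ∣A∣≡n = ≤-antisym (∣p∣≤n A) (≮⇒≥ ∣A∣≮n)
      Δ≡2 : Δ A Y ≡ 2
      Δ≡2 = cong₂ (λ a b → 𝟙 (a ∨ lookup Y v) + 𝟙 (b ∨ lookup Y u)) (∣X∣≡n⇒∈ A ∣A∣≡n u) (∣X∣≡n⇒∈ A ∣A∣≡n v)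
    ... | yes _ | no ∣Y∣≮n = begin
      (2 + ρ) * (∣ A ∣ + ∣ Y ∣) + 2    ≡⟨ cong (λ s → (2 + ρ) * s + 2) (+-comm ∣ A ∣ ∣ Y ∣) ⟩
      (2 + ρ) * (∣ Y ∣ + ∣ A ∣) + 2    ≤⟨ +-monoˡ-≤ 2 (edges-bound-full Y A ∣Y∣≡n) ⟩
      between Y A + (2 + ρ) * n + 2    ≡⟨ cong (λ e → e + (2 + ρ) * n + 2) (between-sym Y A) ⟩
      between A Y + (2 + ρ) * n + 2    ≡⟨ xy∙z≈xz∙y (between A Y) _ 2 ⟩
      between A Y + 2 + (2 + ρ) * n    ≡⟨ cong (λ d → between A Y + d + (2 + ρ) * n) Δ≡2 ⟨
      between A Y + Δ A Y + (2 + ρ) * n ∎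
      where
      open ≤-Reasoning
      ∣Y∣≡n : ∣ Y ∣ ≡ n
      ∣Y∣≡n = ≤-antisym (∣p∣≤n Y) (≮⇒≥ ∣Y∣≮n)
      Δ≡2 : Δ A Y ≡ 2
      Δ≡2 = trans (cong₂ (λ a b → 𝟙 (lookup A u ∨ a) + 𝟙 (lookup A v ∨ b)) (∣X∣≡n⇒∈ Y ∣Y∣≡n v) (∣X∣≡n⇒∈ Y ∣Y∣≡n u))
                  (cong₂ _+_ (cong 𝟙 (∨-zeroʳ (lookup A u))) (cong 𝟙 (∨-zeroʳ (lookup A v))))

    -- Y is where A leaves the cap α unreached; I, Iᶜ and F count the endpoints of uv in A,
    -- the endpoints outside Y, and the removed arcs from A into Y.
    module Accounting (A : Subset n) where

      open ≡-Reasoning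

      Y : Subset n
      Y = tabulate (λ y → does (deg E₀ A y <? α y))
      uncapped capped I Iᶜ F : ℕ
      uncapped = ∑[ y < n ] (if lookup Y y then deg E₀ A y else 0)
      capped   = ∑[ y < n ] (if lookup Y y then 0 else α y)
      I  = 𝟙 (lookup A u) + 𝟙 (lookup A v)
      Iᶜ = 𝟙 (not (lookup Y u)) + 𝟙 (not (lookup Y v))
      F  = (if lookup Y v then 𝟙 (lookup A u) else 0) + (if lookup Y u then 𝟙 (lookup A v) else 0)

      supply≡ : supply E₀ A ≡ uncapped + capped
      supply≡ = trans (sum-cong-≗ pointwise)
                      (∑-distrib-+ (λ y → if lookup Y y then deg E₀ A y else 0) (λ y → if lookup Y y then 0 else α y))
        where
        split-min : ∀ c x → c ⊓ x ≡ (if does (x <? c) then x else 0) + (if does (x <? c) then 0 else c)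
        split-min c x = by-cases (x <? c)
          where
          by-cases : (d : Dec (x < c)) → c ⊓ x ≡ (if does d then x else 0) + (if does d then 0 else c)
          by-cases (yes x<c) = trans (m≥n⇒m⊓n≡n (<⇒≤ x<c)) (sym (+-identityʳ x))
          by-cases (no  x≮c) = m≤n⇒m⊓n≡m (≮⇒≥ x≮c)
        pointwise : ∀ y → α y ⊓ deg E₀ A y ≡ (if lookup Y y then deg E₀ A y else 0) + (if lookup Y y then 0 else α y)
        pointwise y = trans (split-min (α y) (deg E₀ A y))
          (cong (λ b → (if b then deg E₀ A y else 0) + (if b then 0 else α y)) (sym (lookup∘tabulate _ y)))

      demand+I : demand A + I ≡ (2 + ρ) * ∣ A ∣
      demand+I = begin
        demand A + I
          ≡⟨ cong (demand A +_) (∑-endpoint (λ x → 𝟙 (lookup A x))) ⟨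
        demand A + ∑[ x < n ] (if endpoint x then 𝟙 (lookup A x) else 0)
          ≡⟨ ∑-distrib-+ (λ x → if lookup A x then α x else 0) (λ x → if endpoint x then 𝟙 (lookup A x) else 0) ⟨
        ∑[ x < n ] ((if lookup A x then α x else 0) + (if endpoint x then 𝟙 (lookup A x) else 0))
          ≡⟨ sum-cong-≗ (λ x → pointwise (lookup A x) (endpoint x)) ⟩
        ∑[ x < n ] (if lookup A x then 2 + ρ else 0)
          ≡⟨ trans (∑-if (lookup A) (2 + ρ)) (cong (_* (2 + ρ)) (sym ∣ A ∣≡∑)) ⟩
        ∣ A ∣ * (2 + ρ)
          ≡⟨ *-comm ∣ A ∣ (2 + ρ) ⟩
        (2 + ρ) * ∣ A ∣ ∎
        where
        pointwise : ∀ a e → (if a then (2 + ρ) ∸ 𝟙 e else 0) + (if e then 𝟙 a else 0) ≡ (if a then 2 + ρ else 0)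
        pointwise true  true  = m∸n+n≡m (s≤s z≤n)
        pointwise true  false = +-identityʳ (2 + ρ)
        pointwise false true  = refl
        pointwise false false = refl

      between≡ : between A Y ≡ uncapped + F
      between≡ = begin
        between A Y
          ≡⟨ sum-cong-≗ (λ y → cong (λ d → if lookup Y y then d else 0) (deg-split y)) ⟩
        ∑[ y < n ] (if lookup Y y then deg E₀ A y + forcedDeg y else 0)
          ≡⟨ sum-cong-≗ (λ y → if-+ (lookup Y y) (deg E₀ A y) (forcedDeg y)) ⟩
        ∑[ y < n ] ((if lookup Y y then deg E₀ A y else 0) + (if lookup Y y then forcedDeg y else 0))
          ≡⟨ ∑-distrib-+ (λ y → if lookup Y y then deg E₀ A y else 0) (λ y → if lookup Y y then forcedDeg y else 0) ⟩
        uncapped + ∑[ y < n ] (if lookup Y y then forcedDeg y else 0)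
          ≡⟨ cong (uncapped +_) forced-total ⟩
        uncapped + F ∎
        where
        forcedDeg : Fin n → ℕ
        forcedDeg y = ∑[ x < n ] (if forced x y then 𝟙 (lookup A x) else 0)
        if-+ : ∀ b (x z : ℕ) → (if b then x + z else 0) ≡ (if b then x else 0) + (if b then z else 0)
        if-+ true  x z = refl
        if-+ false x z = refl
        deg-split : ∀ y → deg (adj G) A y ≡ deg E₀ A y + forcedDeg y
        deg-split y = trans (sum-cong-≗ (λ x → 𝟙-∧-split (lookup A x) (adj G x y) (forced x y) (forced⇒adj x y)))
                            (∑-distrib-+ (λ x → 𝟙 (lookup A x ∧ E₀ x y)) (λ x → if forced x y then 𝟙 (lookup A x) else 0))
        forced-total : ∑[ y < n ] (if lookup Y y then forcedDeg y else 0) ≡ F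
        forced-total = begin
          ∑[ y < n ] (if lookup Y y then forcedDeg y else 0)
            ≡⟨ sum-cong-≗ (λ y → trans (cong (λ z → if lookup Y y then z else 0) (∑-forced (λ x → 𝟙 (lookup A x)) y))
                                (trans (if-+ (lookup Y y) _ _)
                                       (cong₂ _+_ (if-if (lookup Y y) (y == v) _) (if-if (lookup Y y) (y == u) _)))) ⟩
          ∑[ y < n ] ((if y == v then (if lookup Y y then 𝟙 (lookup A u) else 0) else 0)
                      + (if y == u then (if lookup Y y then 𝟙 (lookup A v) else 0) else 0))
            ≡⟨ ∑-distrib-+ (λ y → if y == v then (if lookup Y y then 𝟙 (lookup A u) else 0) else 0)
                           (λ y → if y == u then (if lookup Y y then 𝟙 (lookup A v) else 0) else 0) ⟩
          _ ≡⟨ cong₂ _+_ (∑-δ v (λ y → if lookup Y y then 𝟙 (lookup A u) else 0))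
                         (∑-δ u (λ y → if lookup Y y then 𝟙 (lookup A v) else 0)) ⟩
          F ∎

      capped+Iᶜ+rY : capped + Iᶜ + (2 + ρ) * ∣ Y ∣ ≡ (2 + ρ) * n
      capped+Iᶜ+rY = begin
        capped + Iᶜ + (2 + ρ) * ∣ Y ∣
          ≡⟨ cong₂ (λ c y → capped + c + y) (sym (∑-endpoint (λ y → 𝟙 (not (lookup Y y)))))
                                             (trans (*-comm (2 + ρ) ∣ Y ∣) (trans (cong (_* (2 + ρ)) ∣ Y ∣≡∑) (sym (∑-if (lookup Y) (2 + ρ))))) ⟩
        capped + ∑[ y < n ] (if endpoint y then 𝟙 (not (lookup Y y)) else 0) + ∑[ y < n ] (if lookup Y y then 2 + ρ else 0)
          ≡⟨ cong (_+ ∑[ y < n ] (if lookup Y y then 2 + ρ else 0)) (∑-distrib-+ (λ y → if lookup Y y then 0 else α y) (λ y → if endpoint y then 𝟙 (not (lookup Y y)) else 0)) ⟨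
        ∑[ y < n ] ((if lookup Y y then 0 else α y) + (if endpoint y then 𝟙 (not (lookup Y y)) else 0))
          + ∑[ y < n ] (if lookup Y y then 2 + ρ else 0)
          ≡⟨ ∑-distrib-+ (λ y → (if lookup Y y then 0 else α y) + (if endpoint y then 𝟙 (not (lookup Y y)) else 0))
                         (λ y → if lookup Y y then 2 + ρ else 0) ⟨
        ∑[ y < n ] ((if lookup Y y then 0 else α y) + (if endpoint y then 𝟙 (not (lookup Y y)) else 0) + (if lookup Y y then 2 + ρ else 0))
          ≡⟨ sum-cong-≗ (λ y → pointwise (lookup Y y) (endpoint y)) ⟩
        ∑[ y < n ] (2 + ρ)
          ≡⟨ ∑-const n (2 + ρ) ⟩
        n * (2 + ρ)
          ≡⟨ *-comm n (2 + ρ) ⟩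
        (2 + ρ) * n ∎
        where
        pointwise : ∀ b e → (if b then 0 else (2 + ρ) ∸ 𝟙 e) + (if e then 𝟙 (not b) else 0) + (if b then 2 + ρ else 0) ≡ 2 + ρ
        pointwise true  true  = refl
        pointwise true  false = refl
        pointwise false true  = trans (+-identityʳ _) (m∸n+n≡m (s≤s z≤n))
        pointwise false false = trans (+-identityʳ _) (+-identityʳ _)

      F+Iᶜ+Δ : F + Iᶜ + Δ A Y ≡ 2 + I
      F+Iᶜ+Δ = trans (regroup₄ (if lookup Y v then 𝟙 (lookup A u) else 0) (if lookup Y u then 𝟙 (lookup A v) else 0)
                                  (𝟙 (not (lookup Y u))) (𝟙 (not (lookup Y v))) (𝟙 (lookup A u ∨ lookup Y v)) (𝟙 (lookup A v ∨ lookup Y u)))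
                   (trans (cong₂ _+_ (pair (lookup A u) (lookup Y v)) (pair (lookup A v) (lookup Y u)))
                                               (regroup₅ (𝟙 (lookup A u)) (𝟙 (lookup A v))))
        where
        pair : ∀ a y → (if y then 𝟙 a else 0) + 𝟙 (not y) + 𝟙 (a ∨ y) ≡ 1 + 𝟙 a
        pair true  true  = refl
        pair true  false = refl
        pair false true  = refl
        pair false false = refl
        regroup₄ : ∀ f₁ f₂ c₁ c₂ d₁ d₂ → f₁ + f₂ + (c₁ + c₂) + (d₁ + d₂) ≡ (f₁ + c₂ + d₁) + (f₂ + c₁ + d₂)
        regroup₄ = solve-∀
        regroup₅ : ∀ a b → 1 + a + (1 + b) ≡ 2 + (a + b)
        regroup₅ = solve-∀

    hall : Hall E₀
    hall A = +-cancelʳ-≤ (I + (2 + ρ) * ∣ Y ∣ + 2) _ _ (begin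
      demand A + (I + (2 + ρ) * ∣ Y ∣ + 2)             ≡⟨ regroup₁ (demand A) I ((2 + ρ) * ∣ Y ∣) ⟩
      demand A + I + (2 + ρ) * ∣ Y ∣ + 2               ≡⟨ cong (λ s → s + (2 + ρ) * ∣ Y ∣ + 2) demand+I ⟩
      (2 + ρ) * ∣ A ∣ + (2 + ρ) * ∣ Y ∣ + 2            ≡⟨ cong (_+ 2) (*-distribˡ-+ (2 + ρ) ∣ A ∣ ∣ Y ∣) ⟨
      (2 + ρ) * (∣ A ∣ + ∣ Y ∣) + 2                    ≤⟨ edges-bound-Δ A Y ⟩
      between A Y + Δ A Y + (2 + ρ) * n                ≡⟨ cong₂ (λ e s → e + Δ A Y + s) between≡ (sym capped+Iᶜ+rY) ⟩
      uncapped + F + Δ A Y + (capped + Iᶜ + (2 + ρ) * ∣ Y ∣) ≡⟨ regroup₂ uncapped F (Δ A Y) capped Iᶜ ((2 + ρ) * ∣ Y ∣) ⟩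
      uncapped + capped + (F + Iᶜ + Δ A Y) + (2 + ρ) * ∣ Y ∣ ≡⟨ cong (λ z → uncapped + capped + z + (2 + ρ) * ∣ Y ∣) F+Iᶜ+Δ ⟩
      uncapped + capped + (2 + I) + (2 + ρ) * ∣ Y ∣     ≡⟨ regroup₃ (uncapped + capped) I ((2 + ρ) * ∣ Y ∣) ⟩
      uncapped + capped + (I + (2 + ρ) * ∣ Y ∣ + 2)     ≡⟨ cong (_+ (I + (2 + ρ) * ∣ Y ∣ + 2)) supply≡ ⟨
      supply E₀ A + (I + (2 + ρ) * ∣ Y ∣ + 2)          ∎)
      where
      open Accounting A
      open ≤-Reasoning
      regroup₁ : ∀ d i y → d + (i + y + 2) ≡ d + i + y + 2
      regroup₁ = solve-∀
      regroup₂ : ∀ s f δ o c y → s + f + δ + (o + c + y) ≡ s + o + (f + c + δ) + y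
      regroup₂ = solve-∀
      regroup₃ : ∀ s i y → s + (2 + i) + y ≡ s + (i + y + 2)
      regroup₃ = solve-∀

-- Fractional factors from the double cover

half : ℕ → ℚ
half a = ℤ.+ a ℚ./ 2

half-+ : ∀ a b → half a ℚ.+ half b ≡ half (a + b)
half-+ a b = ℚ.toℚᵘ-injective (ℚᵘ.≃-trans (ℚ.toℚᵘ-homo-+ (half a) (half b))
  (ℚᵘ.≃-trans (ℚᵘ.+-cong (ℚ.toℚᵘ-fromℚᵘ (ℚᵘ.mkℚᵘ (ℤ.+ a) 1)) (ℚ.toℚᵘ-fromℚᵘ (ℚᵘ.mkℚᵘ (ℤ.+ b) 1)))
  (ℚᵘ.≃-trans unnormalised (ℚᵘ.≃-sym (ℚ.toℚᵘ-fromℚᵘ (ℚᵘ.mkℚᵘ (ℤ.+ (a + b)) 1))))))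
  where
  cross : ∀ (x y : ℤ) → (x ℤ.* ℤ.+ 2 ℤ.+ y ℤ.* ℤ.+ 2) ℤ.* ℤ.+ 2 ≡ (x ℤ.+ y) ℤ.* ℤ.+ 4
  cross = ℤ-Ring.solve-∀
  unnormalised : (ℚᵘ.mkℚᵘ (ℤ.+ a) 1 ℚᵘ.+ ℚᵘ.mkℚᵘ (ℤ.+ b) 1) ℚᵘ.≃ ℚᵘ.mkℚᵘ (ℤ.+ (a + b)) 1
  unnormalised = ℚᵘ.*≡* (trans (cross (ℤ.+ a) (ℤ.+ b)) (cong (ℤ._* ℤ.+ 4) (sym (pos-+ a b))))

half-double : ∀ r → half (r + r) ≡ ℤ.+ r ℚ./ 1
half-double r = ℚ.toℚᵘ-injective (ℚᵘ.≃-trans (ℚ.toℚᵘ-fromℚᵘ (ℚᵘ.mkℚᵘ (ℤ.+ (r + r)) 1))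
  (ℚᵘ.≃-trans unnormalised (ℚᵘ.≃-sym (ℚ.toℚᵘ-fromℚᵘ (ℚᵘ.mkℚᵘ (ℤ.+ r) 0)))))
  where
  cross : ∀ (x : ℤ) → (x ℤ.+ x) ℤ.* ℤ.+ 1 ≡ x ℤ.* ℤ.+ 2
  cross = ℤ-Ring.solve-∀
  unnormalised : ℚᵘ.mkℚᵘ (ℤ.+ (r + r)) 1 ℚᵘ.≃ ℚᵘ.mkℚᵘ (ℤ.+ r) 0
  unnormalised = ℚᵘ.*≡* (trans (cong (ℤ._* ℤ.+ 1) (pos-+ r r)) (cross (ℤ.+ r)))

sumℚ-cong : ∀ n {f g : Fin n → ℚ} → (∀ i → f i ≡ g i) → sumℚ n f ≡ sumℚ n g
sumℚ-cong zero    f≗g = refl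
sumℚ-cong (suc n) f≗g = cong₂ ℚ._+_ (f≗g zero) (sumℚ-cong n (λ i → f≗g (suc i)))

sumℚ-half : ∀ n (k : Fin n → ℕ) → sumℚ n (λ i → half (k i)) ≡ half (sum k)
sumℚ-half zero    k = refl
sumℚ-half (suc n) k = trans (cong (half (k zero) ℚ.+_) (sumℚ-half n (λ i → k (suc i)))) (half-+ (k zero) _)

half-𝟙+𝟙∈[0,1] : ∀ a b → 0ℚ ℚ.≤ half (𝟙 a + 𝟙 b) × half (𝟙 a + 𝟙 b) ℚ.≤ 1ℚ
half-𝟙+𝟙∈[0,1] true  true  = toWitness {a? = 0ℚ ℚ.≤? half 2} _ , toWitness {a? = half 2 ℚ.≤? 1ℚ} _
half-𝟙+𝟙∈[0,1] true  false = toWitness {a? = 0ℚ ℚ.≤? half 1} _ , toWitness {a? = half 1 ℚ.≤? 1ℚ} _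
half-𝟙+𝟙∈[0,1] false true  = toWitness {a? = 0ℚ ℚ.≤? half 1} _ , toWitness {a? = half 1 ℚ.≤? 1ℚ} _
half-𝟙+𝟙∈[0,1] false false = toWitness {a? = 0ℚ ℚ.≤? half 0} _ , toWitness {a? = half 0 ℚ.≤? 1ℚ} _

symmetrised-factor : ∀ {n} (G : Graph n) r (F : BipartiteGraph n) → F ⊆ᴱ adj G →
  (∀ x → rowDeg F x ≡ r) → (∀ y → colDeg F y ≡ r) →
  IsFracFactor G r (λ x y → half (𝟙 (F x y) + 𝟙 (F y x)))
symmetrised-factor {n} G r F F⊆G rows cols =
  (λ x y _ → cong half (+-comm (𝟙 (F x y)) (𝟙 (F y x)))) ,
  (λ x y _ → half-𝟙+𝟙∈[0,1] (F x y) (F y x)) ,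
  vertex-sum
  where
  h : Fin n → Fin n → ℚ
  h x y = half (𝟙 (F x y) + 𝟙 (F y x))
  absent : ∀ x y → adj G x y ≡ false → F x y ≡ false
  absent x y ¬xy with F x y in Fxy
  ... | true  = case trans (sym ¬xy) (F⊆G x y Fxy) of λ ()
  ... | false = refl
  on-edges : ∀ x y → (if adj G x y then h x y else 0ℚ) ≡ h x y
  on-edges x y with adj G x y in xy
  ... | true  = refl
  ... | false rewrite absent x y xy | absent y x (trans (Graph.sym G y x) xy) = refl
  vertex-sum : ∀ x → sumℚ n (λ y → if adj G x y then h x y else 0ℚ) ≡ ℤ.+ r ℚ./ 1
  vertex-sum x = begin
    sumℚ n (λ y → if adj G x y then h x y else 0ℚ) ≡⟨ sumℚ-cong n (on-edges x) ⟩
    sumℚ n (h x)                                   ≡⟨ sumℚ-half n (λ y → 𝟙 (F x y) + 𝟙 (F y x)) ⟩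
    half (∑[ y < n ] (𝟙 (F x y) + 𝟙 (F y x)))      ≡⟨ cong half (∑-distrib-+ (λ y → 𝟙 (F x y)) (λ y → 𝟙 (F y x))) ⟩
    half (rowDeg F x + colDeg F x)                 ≡⟨ cong half (cong₂ _+_ (rows x) (cols x)) ⟩
    half (r + r)                                   ≡⟨ half-double r ⟩
    ℤ.+ r ℚ./ 1                                    ∎
    where open ≡-Reasoning

𝟙-∨-disjoint : ∀ a b → (a ≡ true → b ≡ false) → 𝟙 (a ∨ b) ≡ 𝟙 a + 𝟙 b
𝟙-∨-disjoint true  true  disjoint with () ← disjoint refl
𝟙-∨-disjoint true  false _ = refl
𝟙-∨-disjoint false b     _ = refl

𝟙≡if : ∀ b → 𝟙 b ≡ (if b then 1 else 0)
𝟙≡if true  = refl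
𝟙≡if false = refl

module ForcedFactor (ρ n : ℕ) (G : Graph n)
  (size : 6 * (2 + ρ) * (2 + ρ) + 8 ≤ (2 + ρ) * n + 12 * (2 + ρ))
  (dominating : ∀ (X : Subset n) → Lval (2 + ρ) n ≤ ∣ X ∣ → NeighAll G X)
  (expanding : ∀ (X : Subset n) → ∣ X ∣ < Lval (2 + ρ) n →
    (2 * (2 + ρ) ∸ 1) * (n ∸ 1) * ∣ X ∣ ≤ ∣ N G X ∣ * ((2 + ρ) * (n ∸ 1) ∸ 2))
  (u v : Fin n) (u≢v : u ≢ v) (uv : adj G u v ≡ true) where

  open ForcedEdge ρ n G size dominating expanding u v u≢v
  open DegreeConstrainedSubgraph n α α

  forced-sym : ∀ x y → forced x y ≡ forced y x
  forced-sym x y = trans (cong₂ _∨_ (∧-comm (x == u) (y == v)) (∧-comm (x == v) (y == u))) (∨-comm (y == v ∧ x == u) (y == u ∧ x == v))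

  colDeg-forced : ∀ y → colDeg forced y ≡ 𝟙 (endpoint y)
  colDeg-forced y = begin
    ∑[ x < n ] 𝟙 (forced x y)                             ≡⟨ sum-cong-≗ (λ x → 𝟙≡if (forced x y)) ⟩
    ∑[ x < n ] (if forced x y then 1 else 0)              ≡⟨ ∑-forced (λ _ → 1) y ⟩
    (if y == v then 1 else 0) + (if y == u then 1 else 0) ≡⟨ +-comm (if y == v then 1 else 0) _ ⟩
    (if y == u then 1 else 0) + (if y == v then 1 else 0) ≡⟨ if-∨-disjoint (y == u) (y == v) 1 (not-both y) ⟨
    (if endpoint y then 1 else 0)                         ≡⟨ 𝟙≡if (endpoint y) ⟨
    𝟙 (endpoint y)                                        ∎
    where open ≡-Reasoning

  rowDeg-forced : ∀ x → rowDeg forced x ≡ 𝟙 (endpoint x)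
  rowDeg-forced x = trans (sum-cong-≗ (λ y → cong 𝟙 (forced-sym x y))) (colDeg-forced x)

  through-uv : Factor E₀ → Σ (Fin n → Fin n → ℚ) λ h → IsFracFactor G (2 + ρ) h × h u v ≡ 1ℚ
  through-uv (F , F⊆E₀ , rows , cols) =
    (λ x y → half (𝟙 (F′ x y) + 𝟙 (F′ y x))) ,
    symmetrised-factor G (2 + ρ) F′ F′⊆G rowDeg-F′ colDeg-F′ ,
    cong₂ (λ a b → half (𝟙 a + 𝟙 b)) (F′-forced u v forced-uv) (F′-forced v u (trans (forced-sym v u) forced-uv))
    where
    F′ : BipartiteGraph n
    F′ x y = F x y ∨ forced x y
    forced-uv : forced u v ≡ true
    forced-uv rewrite ==-refl u | ==-refl v = refl
    F′-forced : ∀ x y → forced x y ≡ true → F′ x y ≡ true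
    F′-forced x y f rewrite f = ∨-zeroʳ (F x y)
    F⇒¬forced : ∀ x y → F x y ≡ true → forced x y ≡ false
    F⇒¬forced x y Fxy with forced x y | F⊆E₀ x y Fxy
    ... | false | _ = refl
    ... | true  | E₀xy = case trans (sym E₀xy) (∧-zeroʳ (adj G x y)) of λ ()
    F′⊆G : F′ ⊆ᴱ adj G
    F′⊆G x y F′xy with F x y in Fxy
    ... | true  = ∧-elimˡ (F⊆E₀ x y Fxy)
    ... | false = forced⇒adj uv x y F′xy
    𝟙-F′ : ∀ x y → 𝟙 (F′ x y) ≡ 𝟙 (F x y) + 𝟙 (forced x y)
    𝟙-F′ x y = 𝟙-∨-disjoint (F x y) (forced x y) (F⇒¬forced x y)
    rowDeg-F′ : ∀ x → rowDeg F′ x ≡ 2 + ρ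
    rowDeg-F′ x = begin
      rowDeg F′ x                               ≡⟨ trans (sum-cong-≗ (𝟙-F′ x)) (∑-distrib-+ (λ y → 𝟙 (F x y)) (λ y → 𝟙 (forced x y))) ⟩
      rowDeg F x + rowDeg forced x              ≡⟨ cong₂ _+_ (rows x) (rowDeg-forced x) ⟩
      (2 + ρ) ∸ 𝟙 (endpoint x) + 𝟙 (endpoint x) ≡⟨ m∸n+n≡m (≤-trans (𝟙≤1 (endpoint x)) (s≤s z≤n)) ⟩
      2 + ρ                                     ∎
      where open ≡-Reasoning
    colDeg-F′≤ : ∀ y → colDeg F′ y ≤ 2 + ρ
    colDeg-F′≤ y = begin
      colDeg F′ y                               ≡⟨ trans (sum-cong-≗ (λ x → 𝟙-F′ x y)) (∑-distrib-+ (λ x → 𝟙 (F x y)) (λ x → 𝟙 (forced x y))) ⟩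
      colDeg F y + colDeg forced y              ≤⟨ +-monoˡ-≤ (colDeg forced y) (cols y) ⟩
      α y + colDeg forced y                     ≡⟨ cong (α y +_) (colDeg-forced y) ⟩
      (2 + ρ) ∸ 𝟙 (endpoint y) + 𝟙 (endpoint y) ≡⟨ m∸n+n≡m (≤-trans (𝟙≤1 (endpoint y)) (s≤s z≤n)) ⟩
      2 + ρ                                     ∎
      where open ≤-Reasoning
    colDeg-F′ : ∀ y → colDeg F′ y ≡ 2 + ρ
    colDeg-F′ = ∑-squeeze colDeg-F′≤ (≤-reflexive (trans (sum-cong-≗ (λ x → sym (rowDeg-F′ x))) (∑-comm (λ a b → 𝟙 (F′ a b)))))

corollary3 : (r n : ℕ) → 2 ≤ r → 6 * r * r + 8 ≤ r * n + 12 * r →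
    (G : Graph n) →
    (∀ (X : Subset n) → Lval r n ≤ ∣ X ∣ → NeighAll G X) →
    (∀ (X : Subset n) → ∣ X ∣ < Lval r n →
      (2 * r ∸ 1) * (n ∸ 1) * ∣ X ∣ ≤ ∣ N G X ∣ * (r * (n ∸ 1) ∸ 2)) →
    FracCovered G r
corollary3 .(2 + ρ) n (s≤s (s≤s {n = ρ} z≤n)) size G dominating expanding u v uv =
  ForcedFactor.through-uv ρ n G size dominating expanding u v u≢v uv
    (DegreeConstrainedSubgraph.factor n α α E₀ (hall uv))
  where
  u≢v : u ≢ v
  u≢v refl = contradiction (trans (sym uv) (irrefl G u)) λ ()
  open ForcedEdge ρ n G size dominating expanding u v u≢v
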